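{- Every connected, nonhamiltonian, locally linear graph with $n \ge 3$ vertices has at least $2n$ edges, and for every integer $n \ge 12$ there exists a connected, nonhamiltonian, locally linear graph with $n$ vertices and exactly $2n$ edges. That is, the minimum size of a nonhamiltonian locally linear graph of order $n$ is $2n$.
   Context: All graphs are finite, simple and connected. For a vertex $v$ of a graph $G$, $N(v)$ is the set of neighbours of $v$ and $G[S]$ is the subgraph induced by a vertex set $S$. A graph $G$ is locally linear if for every vertex $v$ of $G$ the induced subgraph $G[N(v)]$ is a path. A graph is hamiltonian if it contains a cycle through all of its vertices. The size of a graph is its number of edges. -}

module Defs where

open import Data.Nat using (ℕ; zero; suc; _+_; _*_; _≤_; _<_)
open import Data.Bool using (Bool; true; false)
open import Data.Fin using (Fin; toℕ; fromℕ<)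
open import Data.Fin.Properties using ()
open import Data.List using (List; length; filter; allFin; concatMap; map)
open import Data.Product using (Σ; ∃; _×_; _,_)
open import Relation.Binary.PropositionalEquality using (_≡_; _≢_)
open import Relation.Nullary using (¬_)
open import Relation.Nullary.Decidable using (_×-dec_)
open import Data.Bool.Properties using () renaming (_≟_ to _≟ᵇ_)
open import Data.Nat.Properties using (_<?_)
open import Function.Definitions using (Injective)

record Graph (n : ℕ) : Set where
  field
    adj   : Fin n → Fin n → Bool
    sym   : ∀ u v → adj u v ≡ adj v u
    irref : ∀ v → adj v v ≡ false

open Graph public

Adj : ∀ {n} → Graph n → Fin n → Fin n → Set
Adj G u v = adj G u v ≡ true

data Reach {n} (G : Graph n) : Fin n → Fin n → Set where
  here : ∀ {v} → Reach G v v
  step : ∀ {u w v} → Adj G u w → Reach G w v → Reach G u v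

Connected : ∀ {n} → Graph n → Set
Connected G = ∀ u v → Reach G u v

size : ∀ {n} → Graph n → ℕ
size {n} G = length (filter (λ p → (toℕ (Data.Product.proj₁ p) <? toℕ (Data.Product.proj₂ p))
                                  ×-dec (adj G (Data.Product.proj₁ p) (Data.Product.proj₂ p) ≟ᵇ true))
                           (concatMap (λ i → map (λ j → (i , j)) (allFin n)) (allFin n)))

cyc : ∀ {n} → Fin n → Fin n
cyc {suc n} i with suc (toℕ i) Data.Nat.<? suc n
... | Relation.Nullary.yes p = fromℕ< p
... | Relation.Nullary.no  _ = Data.Fin.zero

-- Hamiltonian: a cycle through all n ≥ 3 vertices, given as a bijective
-- enumeration f of the vertices (injective on Fin n, hence bijective)
-- with f i adjacent to f (i+1 mod n).
Hamiltonian : ∀ {n} → Graph n → Set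
Hamiltonian {n} G = 3 ≤ n × Σ (Fin n → Fin n) λ f → Injective _≡_ _≡_ f × (∀ i → Adj G (f i) (f (cyc i)))

Dist1 : ℕ → ℕ → Set
Dist1 a b = (suc a ≡ b) Data.Sum.⊎ (suc b ≡ a)
  where import Data.Sum

-- G[N(v)] is a path: it is isomorphic to the path P_k (k ≥ 1) with
-- vertices 0..k-1 and edges {i, i+1}: an injective p : Fin k → Fin n
-- whose image is exactly N(v), and p i ~ p j iff |i - j| = 1.
NbhdIsPath : ∀ {n} → Graph n → Fin n → Set
NbhdIsPath {n} G v =
  Σ ℕ λ k → 1 ≤ k × Σ (Fin k → Fin n) λ p →
    Injective _≡_ _≡_ p
    × (∀ i → Adj G v (p i))
    × (∀ u → Adj G v u → ∃ λ i → p i ≡ u)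
    × (∀ i j → (Adj G (p i) (p j) → Dist1 (toℕ i) (toℕ j))
             × (Dist1 (toℕ i) (toℕ j) → Adj G (p i) (p j)))

LocallyLinear : ∀ {n} → Graph n → Set
LocallyLinear G = ∀ v → NbhdIsPath G v

{-# OPTIONS --safe #-}
-- Call an edge a boundary edge if it lies in exactly one triangle. In a connected locally
-- linear graph with n ≥ 3 vertices and m edges every link is a path with at least two
-- vertices, so a vertex v lies in deg v - 1 triangles and on exactly two boundary edges,
-- the ones to the ends of its link. Hence there are n boundary edges and (2m - n)/3
-- triangles. If no vertex has degree 2, no triangle contains two boundary edges, so
-- n ≤ (2m - n)/3, that is m ≥ 2n. A vertex v of degree 2 can be deleted: G - v is again
-- connected and locally linear, has m - 2 edges, and the edge ab between the neighbours
-- of v becomes a boundary edge. So by induction, if m < 2n then G has a Hamiltonian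
-- cycle made of boundary edges: the one of G - v passes through ab, since a lies on only
-- two boundary edges, and v can be inserted between a and b.
--
-- For the examples, start from a 12-vertex graph with 24 edges containing a 4-cycle
-- a b c d whose sides carry vertices x, y, z, w of degree 2: a Hamiltonian cycle would
-- have to contain the closed walk a x b y c z d w, which misses the other vertices.
-- Joining a new vertex to both ends of a boundary edge adds two edges, keeps the graph
-- locally linear, and creates a new boundary edge, so the construction continues to
-- every n ≥ 12.
module Submission where

open import Defs renaming (sym to adj-sym)
open import Data.Nat
open import Data.Nat.Properties
open import Algebra.Properties.Semiring.Sum +-*-semiring
  using (sum; sum-syntax; sum-cong-≗; sum-remove; ∑-distrib-+; ∑-comm; *-distribˡ-sum)
open import Data.Bool using (Bool; true; false; not; _∧_; _∨_)
open import Data.Bool.ListAction using (any)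
open import Data.Bool.Properties using (T-≡; ∨-comm; ∨-zeroʳ) renaming (_≟_ to _≟ᵇ_)
open import Data.Empty using (⊥; ⊥-elim)
open import Data.Fin using (Fin; zero; suc; toℕ; punchIn; punchOut; opposite; fromℕ; #_)
open import Data.Fin.Properties
  using ( toℕ-injective; toℕ<n; toℕ-fromℕ; toℕ-fromℕ<; punchInᵢ≢i; punchIn-punchOut; punchIn-injective
        ; punchOut-injective; opposite-prop; opposite-involutive; all?; any?; injective⇒≤ )
  renaming (suc-injective to Fin-suc-injective; 0≢1+n to Fin-0≢1+n; _≟_ to _≟ᶠ_)
open import Data.List using (List; []; _∷_; _++_; length; lookup; filter; tabulate; allFin; concatMap; map)
open import Data.List.Properties using (length-++; filter-++; map-tabulate)
open import Data.List.Membership.Propositional using (_∈_; _∉_)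
open import Data.List.Membership.Propositional.Properties using (∈-map⁻)
open import Data.List.Relation.Unary.Any as Any using (here; there)
open import Data.Product using (Σ; ∃; _×_; _,_; proj₁; proj₂)
open import Data.Sum using (_⊎_; inj₁; inj₂; swap) renaming (map to ⊎-map)
open import Function using (_∘_; case_of_; Equivalence)
open import Function.Definitions using (Injective)
open import Level using (0ℓ)
open import Relation.Binary.Definitions using (tri<; tri≈; tri>)
open import Relation.Binary.PropositionalEquality
open import Relation.Nullary using (¬_; Dec; yes; no; does)
open import Relation.Nullary.Decidable using (_×-dec_; _⊎-dec_; _→-dec_; map′; toWitness; toWitnessFalse)
open import Relation.Unary using (Pred; Decidable)

∑-const : ∀ n c → ∑[ i < n ] c ≡ n * c
∑-const zero    c = refl
∑-const (suc n) c = cong (c +_) (∑-const n c)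

∑-zero : ∀ {n} (f : Fin n → ℕ) → (∀ i → f i ≡ 0) → sum f ≡ 0
∑-zero {n} f f≡0 = trans (sum-cong-≗ f≡0) (trans (∑-const n 0) (*-zeroʳ n))

∑-mono-≤ : ∀ {n} {f g : Fin n → ℕ} → (∀ i → f i ≤ g i) → sum f ≤ sum g
∑-mono-≤ {zero}  f≤g = z≤n
∑-mono-≤ {suc n} f≤g = +-mono-≤ (f≤g zero) (∑-mono-≤ (f≤g ∘ suc))

∑-delta : ∀ {n} (c : Fin n) (f : Fin n → ℕ) → (∀ i → i ≢ c → f i ≡ 0) → sum f ≡ f c
∑-delta {suc n} c f f≡0 = begin
  sum f                             ≡⟨ sum-remove {i = c} f ⟩
  f c + ∑[ i < n ] f (punchIn c i)  ≡⟨ cong (f c +_) (∑-zero _ λ i → f≡0 _ (punchInᵢ≢i c i)) ⟩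
  f c + 0                           ≡⟨ +-identityʳ (f c) ⟩
  f c                               ∎
  where open ≡-Reasoning

∑-image : ∀ {k n} (p : Fin k → Fin n) → Injective _≡_ _≡_ p → (f : Fin n → ℕ) →
          (∀ w → f w ≡ 0 ⊎ ∃ λ j → p j ≡ w) → sum f ≡ ∑[ j < k ] f (p j)
∑-image {zero} p _ f supp = ∑-zero f λ w → outside (supp w)
  where
  outside : ∀ {w} → f w ≡ 0 ⊎ ∃ (λ (j : Fin 0) → p j ≡ w) → f w ≡ 0
  outside (inj₁ f≡0) = f≡0
  outside (inj₂ (() , _))
∑-image {suc k} {zero} p _ f supp with p zero
... | ()
∑-image {suc k} {suc n} p p-inj f supp = begin
  sum f                                  ≡⟨ sum-remove {i = v} f ⟩
  f v + ∑[ w < n ] f (punchIn v w)       ≡⟨ cong (f v +_) (∑-image p′ p′-inj (f ∘ punchIn v) supp′) ⟩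
  f v + ∑[ j < k ] f (punchIn v (p′ j))  ≡⟨ cong (f v +_) (sum-cong-≗ (cong f ∘ punchIn-p′)) ⟩
  f v + ∑[ j < k ] f (p (suc j))         ∎
  where
  open ≡-Reasoning
  v : Fin (suc n)
  v = p zero
  v≢p : ∀ j → v ≢ p (suc j)
  v≢p j eq with p-inj eq
  ... | ()
  p′ : Fin k → Fin n
  p′ j = punchOut (v≢p j)
  punchIn-p′ : ∀ j → punchIn v (p′ j) ≡ p (suc j)
  punchIn-p′ j = punchIn-punchOut (v≢p j)
  p′-inj : Injective _≡_ _≡_ p′
  p′-inj {i} {j} eq = Fin-suc-injective (p-inj (begin
    p (suc i)            ≡⟨ punchIn-p′ i ⟨
    punchIn v (p′ i)     ≡⟨ cong (punchIn v) eq ⟩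
    punchIn v (p′ j)     ≡⟨ punchIn-p′ j ⟩
    p (suc j)            ∎))
  supp′ : ∀ w → f (punchIn v w) ≡ 0 ⊎ ∃ λ j → p′ j ≡ w
  supp′ w with supp (punchIn v w)
  ... | inj₁ f≡0          = inj₁ f≡0
  ... | inj₂ (zero , eq)  = ⊥-elim (punchInᵢ≢i v w (sym eq))
  ... | inj₂ (suc j , eq) = inj₂ (j , punchIn-injective v _ _ (trans (punchIn-p′ j) eq))

𝟙 : Bool → ℕ
𝟙 true  = 1
𝟙 false = 0

𝟙≤1 : ∀ b → 𝟙 b ≤ 1
𝟙≤1 true  = s≤s z≤n
𝟙≤1 false = z≤n

<ᵇ-true : ∀ {m n} → m < n → (m <ᵇ n) ≡ true
<ᵇ-true = Equivalence.to T-≡ ∘ <⇒<ᵇ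

<ᵇ-true⇒< : ∀ {m n} → (m <ᵇ n) ≡ true → m < n
<ᵇ-true⇒< {m} {n} = <ᵇ⇒< m n ∘ Equivalence.from T-≡

≡ᵇ-true⇒≡ : ∀ {m n} → (m ≡ᵇ n) ≡ true → m ≡ n
≡ᵇ-true⇒≡ {m} {n} = ≡ᵇ⇒≡ m n ∘ Equivalence.from T-≡

𝟙-∨ : ∀ x y → (x ≡ true → y ≡ true → ⊥) → 𝟙 (x ∨ y) ≡ 𝟙 x + 𝟙 y
𝟙-∨ true  true  excl = ⊥-elim (excl refl refl)
𝟙-∨ true  false _    = refl
𝟙-∨ false y     _    = refl

𝟙-does : ∀ {P : Set} (b : Bool) (d : Dec P) → (b ≡ true → P) → (P → b ≡ true) → 𝟙 b ≡ 𝟙 (does d)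
𝟙-does true  (yes _) _ _ = refl
𝟙-does false (no _)  _ _ = refl
𝟙-does true  (no ¬p) b⇒p _ = ⊥-elim (¬p (b⇒p refl))
𝟙-does false (yes p) _ p⇒b with p⇒b p
... | ()

-- The path P_k on 0, …, k - 1
Dist1? : ∀ a b → Dec (Dist1 a b)
Dist1? a b = (suc a ≟ b) ⊎-dec (suc b ≟ a)

pathDeg : ∀ {k} → Fin k → ℕ
pathDeg {k} j = ∑[ i < k ] 𝟙 (does (Dist1? (toℕ j) (toℕ i)))

PathEnd : ∀ {k} → Fin k → Set
PathEnd {k} j = toℕ j ≡ 0 ⊎ suc (toℕ j) ≡ k

∑-𝟙-≡ᵇ : ∀ k m → ∑[ i < k ] 𝟙 (m ≡ᵇ toℕ i) ≡ 𝟙 (m <ᵇ k)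
∑-𝟙-≡ᵇ zero    m       = refl
∑-𝟙-≡ᵇ (suc k) zero    = cong suc (∑-zero {k} _ λ _ → refl)
∑-𝟙-≡ᵇ (suc k) (suc m) = ∑-𝟙-≡ᵇ k m

∑-𝟙-≡ᵇʳ : ∀ k m → ∑[ i < k ] 𝟙 (toℕ i ≡ᵇ m) ≡ 𝟙 (m <ᵇ k)
∑-𝟙-≡ᵇʳ zero    m       = refl
∑-𝟙-≡ᵇʳ (suc k) zero    = cong suc (∑-zero {k} _ λ _ → refl)
∑-𝟙-≡ᵇʳ (suc k) (suc m) = ∑-𝟙-≡ᵇʳ k m

pathDeg≡ : ∀ {k} (j : Fin k) → pathDeg j ≡ 𝟙 (suc (toℕ j) <ᵇ k) + 𝟙 (0 <ᵇ toℕ j)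
pathDeg≡ {k} j = begin
  pathDeg j
    ≡⟨ sum-cong-≗ {k} (λ i → 𝟙-∨ _ _ λ e₁ e₂ → not-both (toℕ j) (toℕ i) (≡ᵇ-true⇒≡ e₁) (≡ᵇ-true⇒≡ e₂)) ⟩
  ∑[ i < k ] (𝟙 (suc (toℕ j) ≡ᵇ toℕ i) + 𝟙 (suc (toℕ i) ≡ᵇ toℕ j))
    ≡⟨ ∑-distrib-+ {k} (λ i → 𝟙 (suc (toℕ j) ≡ᵇ toℕ i)) (λ i → 𝟙 (suc (toℕ i) ≡ᵇ toℕ j)) ⟩
  ∑[ i < k ] 𝟙 (suc (toℕ j) ≡ᵇ toℕ i) + ∑[ i < k ] 𝟙 (suc (toℕ i) ≡ᵇ toℕ j)
    ≡⟨ cong₂ _+_ (∑-𝟙-≡ᵇ k (suc (toℕ j))) (hasPred (toℕ j) (toℕ<n j)) ⟩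
  𝟙 (suc (toℕ j) <ᵇ k) + 𝟙 (0 <ᵇ toℕ j) ∎
  where
  open ≡-Reasoning
  not-both : ∀ a b → suc a ≡ b → suc b ≡ a → ⊥
  not-both a .(suc a) refl e = m+1+n≢n 1 e
  hasPred : ∀ m → m < k → ∑[ i < k ] 𝟙 (suc (toℕ i) ≡ᵇ m) ≡ 𝟙 (0 <ᵇ m)
  hasPred zero    _   = ∑-zero {k} _ λ _ → refl
  hasPred (suc m) m<k = trans (∑-𝟙-≡ᵇʳ k m) (cong 𝟙 (<ᵇ-true (<-trans (n<1+n m) m<k)))

∑-pathDeg : ∀ k → ∑[ j < k ] pathDeg j ≡ 2 * (k ∸ 1)
∑-pathDeg k = begin
  ∑[ j < k ] pathDeg j                                         ≡⟨ sum-cong-≗ {k} pathDeg≡ ⟩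
  ∑[ j < k ] (𝟙 (suc (toℕ j) <ᵇ k) + 𝟙 (0 <ᵇ toℕ j))          ≡⟨ ∑-distrib-+ {k} _ _ ⟩
  ∑[ j < k ] 𝟙 (suc (toℕ j) <ᵇ k) + ∑[ j < k ] 𝟙 (0 <ᵇ toℕ j) ≡⟨ cong₂ _+_ (succs k) (preds k) ⟩
  (k ∸ 1) + (k ∸ 1)                                            ≡⟨ cong ((k ∸ 1) +_) (+-identityʳ (k ∸ 1)) ⟨
  2 * (k ∸ 1)                                                  ∎
  where
  open ≡-Reasoning
  succs : ∀ k → ∑[ j < k ] 𝟙 (suc (toℕ j) <ᵇ k) ≡ k ∸ 1
  succs zero          = refl
  succs (suc zero)    = refl
  succs (suc (suc k)) = cong suc (succs (suc k))
  preds : ∀ k → ∑[ j < k ] 𝟙 (0 <ᵇ toℕ j) ≡ k ∸ 1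
  preds zero    = refl
  preds (suc k) = trans (∑-const k 1) (*-identityʳ k)

pathDeg≤2 : ∀ {k} (j : Fin k) → pathDeg j ≤ 2
pathDeg≤2 {k} j rewrite pathDeg≡ j = +-mono-≤ (𝟙≤1 (suc (toℕ j) <ᵇ k)) (𝟙≤1 (0 <ᵇ toℕ j))

pathDeg≥1 : ∀ {k} (j : Fin k) → 2 ≤ k → 1 ≤ pathDeg j
pathDeg≥1 {k} j 2≤k rewrite pathDeg≡ j with toℕ j
... | zero  rewrite <ᵇ-true 2≤k = ≤-refl
... | suc _ = m≤n+m 1 _

pathDeg≡1⇒PathEnd : ∀ {k} (j : Fin k) → pathDeg j ≡ 1 → PathEnd j
pathDeg≡1⇒PathEnd {k} j deg≡1 rewrite pathDeg≡ j with toℕ j in eq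
... | zero  = inj₁ refl
... | suc m with suc (suc m) <ᵇ k in lt
...   | true  = ⊥-elim (1+n≢n deg≡1)
...   | false = inj₂ (≤-antisym (subst (λ t → suc t ≤ k) eq (toℕ<n j))
                                 (≮⇒≥ λ 2+m<k → case trans (sym (<ᵇ-true 2+m<k)) lt of λ ()))

PathEnd-neighbour : ∀ {k} (j₀ j : Fin k) → 3 ≤ k → PathEnd j₀ → Dist1 (toℕ j₀) (toℕ j) → pathDeg j ≡ 2
PathEnd-neighbour {k} j₀ j 3≤k (inj₁ j₀≡0) (inj₁ 1+j₀≡j)
  rewrite pathDeg≡ j | sym 1+j₀≡j | j₀≡0 | <ᵇ-true 3≤k = refl
PathEnd-neighbour {k} j₀ j 3≤k (inj₁ j₀≡0) (inj₂ 1+j≡j₀) = ⊥-elim (1+n≢0 (trans 1+j≡j₀ j₀≡0))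
PathEnd-neighbour {k} j₀ j 3≤k (inj₂ 1+j₀≡k) (inj₁ 1+j₀≡j) =
  ⊥-elim (<-irrefl (trans (sym 1+j₀≡j) 1+j₀≡k) (toℕ<n j))
PathEnd-neighbour {k} j₀ j 3≤k (inj₂ 1+j₀≡k) (inj₂ 1+j≡j₀)
  rewrite pathDeg≡ j | <ᵇ-true (subst (_< k) (sym 1+j≡j₀) (toℕ<n j₀)) = cong suc (hasPred (toℕ j) refl)
  where
  hasPred : ∀ t → t ≡ toℕ j → 𝟙 (0 <ᵇ t) ≡ 1
  hasPred zero    t≡j = ⊥-elim (<-irrefl (begin
    2                    ≡⟨ cong (λ t → 2 + t) t≡j ⟩
    suc (suc (toℕ j))    ≡⟨ cong suc 1+j≡j₀ ⟩
    suc (toℕ j₀)         ≡⟨ 1+j₀≡k ⟩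
    k                    ∎) 3≤k)
    where open ≡-Reasoning
  hasPred (suc t) _   = refl

∑-PathEnds : ∀ k → 2 ≤ k → ∑[ j < k ] 𝟙 (pathDeg j ≡ᵇ 1) ≡ 2
∑-PathEnds k 2≤k = +-cancelʳ-≡ (2 * (k ∸ 1)) _ _ (begin
  ∑[ j < k ] 𝟙 (pathDeg j ≡ᵇ 1) + 2 * (k ∸ 1)          ≡⟨ cong₂ _+_ (sum-cong-≗ {k} ends≡) (sym (∑-pathDeg k)) ⟩
  ∑[ j < k ] (2 ∸ pathDeg j) + ∑[ j < k ] pathDeg j   ≡⟨ ∑-distrib-+ {k} _ _ ⟨
  ∑[ j < k ] (2 ∸ pathDeg j + pathDeg j)              ≡⟨ sum-cong-≗ {k} (λ j → m∸n+n≡m (pathDeg≤2 j)) ⟩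
  ∑[ j < k ] 2                                        ≡⟨ ∑-const k 2 ⟩
  k * 2                                               ≡⟨ twice k 2≤k ⟩
  2 + 2 * (k ∸ 1)                                     ∎)
  where
  open ≡-Reasoning
  ends≡ : ∀ j → 𝟙 (pathDeg j ≡ᵇ 1) ≡ 2 ∸ pathDeg j
  ends≡ j with pathDeg j | pathDeg≥1 j 2≤k | pathDeg≤2 j
  ... | 1 | _ | _ = refl
  ... | 2 | _ | _ = refl
  ... | suc (suc (suc _)) | _ | s≤s (s≤s ())
  twice : ∀ k → 2 ≤ k → k * 2 ≡ 2 + 2 * (k ∸ 1)
  twice (suc k) _ = trans (*-comm (suc k) 2) (*-suc 2 k)

adjacent-PathEnds : ∀ {k} (i j : Fin k) → PathEnd i → PathEnd j → i ≢ j → Dist1 (toℕ i) (toℕ j) → k ≡ 2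
adjacent-PathEnds i j (inj₁ i≡0)  (inj₁ j≡0)  i≢j _ = ⊥-elim (i≢j (toℕ-injective (trans i≡0 (sym j≡0))))
adjacent-PathEnds i j (inj₂ i+1≡k) (inj₂ j+1≡k) i≢j _ =
  ⊥-elim (i≢j (toℕ-injective (suc-injective (trans i+1≡k (sym j+1≡k)))))
adjacent-PathEnds i j (inj₁ i≡0)  (inj₂ j+1≡k) _ (inj₁ i+1≡j) =
  trans (sym j+1≡k) (cong suc (trans (sym i+1≡j) (cong suc i≡0)))
adjacent-PathEnds i j (inj₂ i+1≡k) (inj₁ j≡0)  _ (inj₂ j+1≡i) =
  trans (sym i+1≡k) (cong suc (trans (sym j+1≡i) (cong suc j≡0)))
adjacent-PathEnds i j (inj₁ i≡0)  (inj₂ _)    _ (inj₂ j+1≡i) = ⊥-elim (1+n≢0 (trans j+1≡i i≡0))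
adjacent-PathEnds i j (inj₂ _)    (inj₁ j≡0)  _ (inj₁ i+1≡j) = ⊥-elim (1+n≢0 (trans i+1≡j j≡0))

no-three-PathEnds : ∀ {k} {i j l : Fin k} → PathEnd i → PathEnd j → PathEnd l → i ≢ j → i ≢ l → j ≢ l → ⊥
no-three-PathEnds {i = i} {j} {l} eᵢ eⱼ eₗ i≢j i≢l j≢l = case eᵢ eⱼ eₗ
  where
  case : PathEnd i → PathEnd j → PathEnd l → ⊥
  case (inj₁ i≡0) (inj₁ j≡0) _ = i≢j (toℕ-injective (trans i≡0 (sym j≡0)))
  case (inj₂ i≡) (inj₂ j≡) _ = i≢j (toℕ-injective (suc-injective (trans i≡ (sym j≡))))
  case (inj₁ i≡0) _ (inj₁ l≡0) = i≢l (toℕ-injective (trans i≡0 (sym l≡0)))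
  case (inj₂ i≡) _ (inj₂ l≡) = i≢l (toℕ-injective (suc-injective (trans i≡ (sym l≡))))
  case _ (inj₁ j≡0) (inj₁ l≡0) = j≢l (toℕ-injective (trans j≡0 (sym l≡0)))
  case _ (inj₂ j≡) (inj₂ l≡) = j≢l (toℕ-injective (suc-injective (trans j≡ (sym l≡))))

Dist1-suc⁻¹ : ∀ {a b} → Dist1 (suc a) (suc b) → Dist1 a b
Dist1-suc⁻¹ (inj₁ eq) = inj₁ (suc-injective eq)
Dist1-suc⁻¹ (inj₂ eq) = inj₂ (suc-injective eq)

Dist1-suc : ∀ {a b} → Dist1 a b → Dist1 (suc a) (suc b)
Dist1-suc (inj₁ eq) = inj₁ (cong suc eq)
Dist1-suc (inj₂ eq) = inj₂ (cong suc eq)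

opposite-step : ∀ {k} (i j : Fin k) → suc (toℕ i) ≡ toℕ j → suc (toℕ (opposite j)) ≡ toℕ (opposite i)
opposite-step {k} i j 1+i≡j = begin
  suc (toℕ (opposite j))   ≡⟨ cong suc (opposite-prop j) ⟩
  suc (k ∸ suc (toℕ j))    ≡⟨ +-∸-assoc 1 (toℕ<n j) ⟨
  k ∸ toℕ j                ≡⟨ cong (k ∸_) 1+i≡j ⟨
  k ∸ suc (toℕ i)          ≡⟨ opposite-prop i ⟨
  toℕ (opposite i)         ∎
  where open ≡-Reasoning

Dist1-opposite : ∀ {k} {i j : Fin k} → Dist1 (toℕ i) (toℕ j) → Dist1 (toℕ (opposite i)) (toℕ (opposite j))
Dist1-opposite {i = i} {j} (inj₁ 1+i≡j) = inj₂ (opposite-step i j 1+i≡j)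
Dist1-opposite {i = i} {j} (inj₂ 1+j≡i) = inj₁ (opposite-step j i 1+j≡i)

-- Counting edges, common neighbours and boundary edges
module _ {A : Set} {P : Pred A 0ℓ} (P? : Decidable P) where

  length-filter-∷ : ∀ x xs → length (filter P? (x ∷ xs)) ≡ 𝟙 (does (P? x)) + length (filter P? xs)
  length-filter-∷ x xs with does (P? x)
  ... | true  = refl
  ... | false = refl

  length-filter-tabulate : ∀ {n} (g : Fin n → A) → length (filter P? (tabulate g)) ≡ ∑[ i < n ] 𝟙 (does (P? (g i)))
  length-filter-tabulate {zero}  g = refl
  length-filter-tabulate {suc n} g =
    trans (length-filter-∷ (g zero) _) (cong (𝟙 (does (P? (g zero))) +_) (length-filter-tabulate (g ∘ suc)))

  length-filter-concatMap : ∀ {B : Set} {n} (f : B → List A) (g : Fin n → B) →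
    length (filter P? (concatMap f (tabulate g))) ≡ ∑[ i < n ] length (filter P? (f (g i)))
  length-filter-concatMap {n = zero}  f g = refl
  length-filter-concatMap {n = suc n} f g = begin
    length (filter P? (f (g zero) ++ concatMap f (tabulate (g ∘ suc))))
      ≡⟨ cong length (filter-++ P? (f (g zero)) _) ⟩
    length (filter P? (f (g zero)) ++ filter P? (concatMap f (tabulate (g ∘ suc))))
      ≡⟨ length-++ (filter P? (f (g zero))) ⟩
    length (filter P? (f (g zero))) + length (filter P? (concatMap f (tabulate (g ∘ suc))))
      ≡⟨ cong (length (filter P? (f (g zero))) +_) (length-filter-concatMap f (g ∘ suc)) ⟩
    length (filter P? (f (g zero))) + ∑[ i < n ] length (filter P? (f (g (suc i)))) ∎
    where open ≡-Reasoning

module _ {n : ℕ} (G : Graph n) where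

  A : Fin n → Fin n → ℕ
  A u w = 𝟙 (adj G u w)

  deg : Fin n → ℕ
  deg u = ∑[ w < n ] A u w

  A-sym : ∀ u w → A u w ≡ A w u
  A-sym u w = cong 𝟙 (adj-sym G u w)

  A-irrefl : ∀ u → A u u ≡ 0
  A-irrefl u = cong 𝟙 (irref G u)

  Adj⇒A≡1 : ∀ {u w} → Adj G u w → A u w ≡ 1
  Adj⇒A≡1 = cong 𝟙

  A≡0⊎Adj : ∀ u w → A u w ≡ 0 ⊎ Adj G u w
  A≡0⊎Adj u w with adj G u w
  ... | true  = inj₂ refl
  ... | false = inj₁ refl

  Adj-sym : ∀ {u w} → Adj G u w → Adj G w u
  Adj-sym {u} {w} = trans (adj-sym G w u)

  Adj-irrefl : ∀ u → ¬ Adj G u u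
  Adj-irrefl u uu with trans (sym uu) (irref G u)
  ... | ()

  Adj⇒≢ : ∀ {u w} → Adj G u w → u ≢ w
  Adj⇒≢ {u} uw refl = Adj-irrefl u uw

  size≡ : size G ≡ ∑[ i < n ] ∑[ j < n ] (𝟙 (toℕ i <ᵇ toℕ j) * A i j)
  size≡ = trans (length-filter-concatMap P? (λ i → map (i ,_) (allFin n)) (λ i → i))
    (sum-cong-≗ {n} λ i → trans (cong (length ∘ filter P?) (map-tabulate′ i))
      (trans (length-filter-tabulate P? (i ,_)) (sum-cong-≗ {n} λ j → 𝟙-∧ (toℕ i <ᵇ toℕ j) (adj G i j))))
    where
    P? : Decidable λ (p : Fin n × Fin n) → toℕ (proj₁ p) < toℕ (proj₂ p) × adj G (proj₁ p) (proj₂ p) ≡ true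
    P? (i , j) = (toℕ i <? toℕ j) ×-dec (adj G i j ≟ᵇ true)
    map-tabulate′ : ∀ i → map (i ,_) (allFin n) ≡ tabulate (i ,_)
    map-tabulate′ i = map-tabulate (λ j → j) (i ,_)
    𝟙-∧ : ∀ a b → 𝟙 (a ∧ does (b ≟ᵇ true)) ≡ 𝟙 a * 𝟙 b
    𝟙-∧ true  true  = refl
    𝟙-∧ true  false = refl
    𝟙-∧ false _     = refl

  handshake : ∑[ u < n ] deg u ≡ 2 * size G
  handshake = begin
    ∑[ i < n ] ∑[ j < n ] A i j
                                               ≡⟨ sum-cong-≗ {n} (λ i → trans (sum-cong-≗ {n} (split i)) (∑-distrib-+ {n} _ _)) ⟩
    ∑[ i < n ] (∑[ j < n ] below i j + ∑[ j < n ] below j i)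
                                               ≡⟨ ∑-distrib-+ {n} _ _ ⟩
    S + ∑[ i < n ] ∑[ j < n ] below j i        ≡⟨ cong (S +_) (∑-comm {n} {n} (λ i j → below j i)) ⟩
    S + S                                      ≡⟨ cong (S +_) (+-identityʳ S) ⟨
    2 * S                                      ≡⟨ cong (2 *_) size≡ ⟨
    2 * size G                                 ∎
    where
    open ≡-Reasoning
    below : Fin n → Fin n → ℕ
    below i j = 𝟙 (toℕ i <ᵇ toℕ j) * A i j
    S : ℕ
    S = ∑[ i < n ] ∑[ j < n ] below i j
    𝟙-<ᵇ : ∀ {a b} → a < b → 𝟙 (a <ᵇ b) ≡ 1
    𝟙-<ᵇ a<b = cong 𝟙 (<ᵇ-true a<b)
    𝟙-≮ᵇ : ∀ {a b} → ¬ a < b → 𝟙 (a <ᵇ b) ≡ 0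
    𝟙-≮ᵇ {a} {b} a≮b with a <ᵇ b in eq
    ... | true  = ⊥-elim (a≮b (<ᵇ-true⇒< eq))
    ... | false = refl
    split : ∀ i j → A i j ≡ below i j + below j i
    split i j with <-cmp (toℕ i) (toℕ j)
    ... | tri< i<j _ j≮i rewrite 𝟙-<ᵇ i<j | 𝟙-≮ᵇ j≮i = sym (trans (+-identityʳ (1 * A i j)) (*-identityˡ (A i j)))
    ... | tri> i≮j _ j<i rewrite 𝟙-<ᵇ j<i | 𝟙-≮ᵇ i≮j = trans (A-sym i j) (sym (*-identityˡ (A j i)))
    ... | tri≈ _ i≡j _ rewrite toℕ-injective i≡j | A-irrefl j | *-zeroʳ (𝟙 (toℕ j <ᵇ toℕ j)) = refl

  Reach-trans : ∀ {x y z} → Reach G x y → Reach G y z → Reach G x z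
  Reach-trans here         r = r
  Reach-trans (step xw wy) r = step xw (Reach-trans wy r)

  Reach-sym : ∀ {x y} → Reach G x y → Reach G y x
  Reach-sym here         = here
  Reach-sym (step xw wy) = Reach-trans (Reach-sym wy) (step (Adj-sym xw) here)

  common : Fin n → Fin n → ℕ
  common u w = ∑[ x < n ] (A u x * A w x)

  common-sym : ∀ u w → common u w ≡ common w u
  common-sym u w = sum-cong-≗ {n} λ x → *-comm (A u x) (A w x)

  triangle : Fin n → Fin n → Fin n → ℕ
  triangle u w x = A u w * A w x * A x u

  triangle-rotate : ∀ u w x → triangle u w x ≡ triangle w x u
  triangle-rotate u w x = trans (*-assoc (A u w) _ _) (*-comm (A u w) _)

  ∑-triangle : ∀ u w → ∑[ x < n ] triangle u w x ≡ A u w * common u w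
  ∑-triangle u w = trans (sum-cong-≗ {n} λ x → trans (*-assoc (A u w) _ _) (cong (A u w *_) (reorder x)))
                         (sym (*-distribˡ-sum (A u w) λ x → A u x * A w x))
    where
    reorder : ∀ x → A w x * A x u ≡ A u x * A w x
    reorder x = trans (*-comm (A w x) _) (cong (_* A w x) (A-sym x u))

  boundary : Fin n → Fin n → ℕ
  boundary u w = A u w * 𝟙 (common u w ≡ᵇ 1)

  boundary-sym : ∀ u w → boundary u w ≡ boundary w u
  boundary-sym u w = cong₂ (λ a c → a * 𝟙 (c ≡ᵇ 1)) (A-sym u w) (common-sym u w)

  boundary≡0⊎1 : ∀ u w → boundary u w ≡ 0 ⊎ boundary u w ≡ 1
  boundary≡0⊎1 u w with adj G u w | common u w ≡ᵇ 1
  ... | true  | true  = inj₂ refl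
  ... | true  | false = inj₁ refl
  ... | false | _     = inj₁ refl

  boundary⇒Adj : ∀ {u w} → boundary u w ≡ 1 → Adj G u w
  boundary⇒Adj {u} {w} b≡1 with adj G u w
  ... | true = refl

  boundary⇒common≡1 : ∀ {u w} → boundary u w ≡ 1 → common u w ≡ 1
  boundary⇒common≡1 {u} {w} b≡1 with adj G u w | common u w ≡ᵇ 1 in eq
  ... | true | true = ≡ᵇ-true⇒≡ eq

  boundary-intro : ∀ {u w} → Adj G u w → common u w ≡ 1 → boundary u w ≡ 1
  boundary-intro uw c≡1 rewrite Adj⇒A≡1 uw | c≡1 = refl

  triangles-on-boundary : ∀ u w → A u w * common u w * boundary u w ≡ boundary u w
  triangles-on-boundary u w with adj G u w | common u w
  ... | false | _             = refl
  ... | true  | zero          = refl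
  ... | true  | suc zero      = refl
  ... | true  | suc (suc c)   = *-zeroʳ (suc (suc c) + 0)

  record IsPathOn (N : Fin n → Set) {k} (p : Fin k → Fin n) : Set where
    field
      injective  : Injective _≡_ _≡_ p
      within     : ∀ i → N (p i)
      onto       : ∀ u → N u → ∃ λ i → p i ≡ u
      edge⇒Dist1 : ∀ i j → Adj G (p i) (p j) → Dist1 (toℕ i) (toℕ j)
      Dist1⇒edge : ∀ i j → Dist1 (toℕ i) (toℕ j) → Adj G (p i) (p j)

  PathOn : (Fin n → Set) → Set
  PathOn N = Σ ℕ λ k → 1 ≤ k × Σ (Fin k → Fin n) (IsPathOn N)

  len : ∀ {N} → PathOn N → ℕ
  len = proj₁

  toPathOn : ∀ {v} → NbhdIsPath G v → PathOn (Adj G v)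
  toPathOn (k , k≥1 , p , p-inj , p-adj , p-onto , p-edge) = k , k≥1 , p , record
    { injective = p-inj ; within = p-adj ; onto = p-onto
    ; edge⇒Dist1 = λ i j → proj₁ (p-edge i j) ; Dist1⇒edge = λ i j → proj₂ (p-edge i j) }

  fromPathOn : ∀ {v} → PathOn (Adj G v) → NbhdIsPath G v
  fromPathOn (k , k≥1 , p , P) = k , k≥1 , p , injective , within , onto , λ i j → edge⇒Dist1 i j , Dist1⇒edge i j
    where open IsPathOn P

  module LinkProperties {v : Fin n} {k} {p : Fin k → Fin n} (P : IsPathOn (Adj G v) p) where
    open IsPathOn P

    ∑-over-link : (h : Fin n → ℕ) → ∑[ w < n ] (A v w * h w) ≡ ∑[ i < k ] h (p i)
    ∑-over-link h = trans (∑-image p injective _ supp)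
                          (sum-cong-≗ {k} λ i → trans (cong (_* h (p i)) (Adj⇒A≡1 (within i))) (+-identityʳ _))
      where
      supp : ∀ w → A v w * h w ≡ 0 ⊎ ∃ λ i → p i ≡ w
      supp w with A≡0⊎Adj v w
      ... | inj₁ A≡0 = inj₁ (cong (_* h w) A≡0)
      ... | inj₂ vw  = inj₂ (onto w vw)

    deg≡len : deg v ≡ k
    deg≡len = begin
      ∑[ w < n ] A v w        ≡⟨ sum-cong-≗ {n} (λ w → *-identityʳ (A v w)) ⟨
      ∑[ w < n ] (A v w * 1)  ≡⟨ ∑-over-link (λ _ → 1) ⟩
      ∑[ i < k ] 1            ≡⟨ ∑-const k 1 ⟩
      k * 1                   ≡⟨ *-identityʳ k ⟩
      k                       ∎
      where open ≡-Reasoning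

    A-on-path : ∀ i j → A (p i) (p j) ≡ 𝟙 (does (Dist1? (toℕ i) (toℕ j)))
    A-on-path i j = 𝟙-does (adj G (p i) (p j)) (Dist1? (toℕ i) (toℕ j)) (edge⇒Dist1 i j) (Dist1⇒edge i j)

    common≡pathDeg : ∀ j → common v (p j) ≡ pathDeg j
    common≡pathDeg j = begin
      common v (p j)            ≡⟨ ∑-over-link (A (p j)) ⟩
      ∑[ i < k ] A (p j) (p i)  ≡⟨ sum-cong-≗ {k} (A-on-path j) ⟩
      pathDeg j                 ∎
      where open ≡-Reasoning

    ∑-triangles-at : ∑[ w < n ] ∑[ x < n ] triangle v w x ≡ 2 * (deg v ∸ 1)
    ∑-triangles-at = begin
      ∑[ w < n ] ∑[ x < n ] triangle v w x  ≡⟨ sum-cong-≗ {n} (∑-triangle v) ⟩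
      ∑[ w < n ] (A v w * common v w)       ≡⟨ ∑-over-link (common v) ⟩
      ∑[ i < k ] common v (p i)             ≡⟨ sum-cong-≗ {k} common≡pathDeg ⟩
      ∑[ i < k ] pathDeg i                  ≡⟨ ∑-pathDeg k ⟩
      2 * (k ∸ 1)                           ≡⟨ cong (λ d → 2 * (d ∸ 1)) deg≡len ⟨
      2 * (deg v ∸ 1)                       ∎
      where open ≡-Reasoning

    ∑-boundary-at : 2 ≤ k → ∑[ w < n ] boundary v w ≡ 2
    ∑-boundary-at 2≤k = begin
      ∑[ w < n ] boundary v w             ≡⟨ ∑-over-link (λ w → 𝟙 (common v w ≡ᵇ 1)) ⟩
      ∑[ i < k ] 𝟙 (common v (p i) ≡ᵇ 1)  ≡⟨ sum-cong-≗ {k} (cong (λ c → 𝟙 (c ≡ᵇ 1)) ∘ common≡pathDeg) ⟩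
      ∑[ i < k ] 𝟙 (pathDeg i ≡ᵇ 1)       ≡⟨ ∑-PathEnds k 2≤k ⟩
      2                                   ∎
      where open ≡-Reasoning

    common≡1⇒PathEnd : ∀ {w} → Adj G v w → common v w ≡ 1 → ∃ λ j → p j ≡ w × PathEnd j
    common≡1⇒PathEnd {w} vw c≡1 with onto w vw
    ... | j , refl = j , refl , pathDeg≡1⇒PathEnd j (trans (sym (common≡pathDeg j)) c≡1)

module _ {n} (G : Graph n) where

  open IsPathOn

  reverse : ∀ {N k} {p : Fin k → Fin n} → IsPathOn G N p → IsPathOn G N (p ∘ opposite)
  reverse {k = k} {p} P = record
    { injective  = opposite-injective ∘ injective P
    ; within     = within P ∘ opposite
    ; onto       = λ u Nu → let (i , pi≡u) = onto P u Nu in opposite i , trans (cong p (opposite-involutive i)) pi≡u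
    ; edge⇒Dist1 = λ i j e → subst₂ (λ a b → Dist1 (toℕ a) (toℕ b)) (opposite-involutive i) (opposite-involutive j)
                                     (Dist1-opposite (edge⇒Dist1 P _ _ e))
    ; Dist1⇒edge = λ i j d → Dist1⇒edge P _ _ (Dist1-opposite d)
    }
    where
    opposite-injective : ∀ {i j} → opposite {k} i ≡ opposite j → i ≡ j
    opposite-injective {i} {j} eq = trans (sym (opposite-involutive i)) (trans (cong opposite eq) (opposite-involutive j))

  orient : ∀ {N k} {p : Fin (suc k) → Fin n} → IsPathOn G N p → ∀ j → PathEnd j →
           Σ (Fin (suc k) → Fin n) λ q → IsPathOn G N q × q zero ≡ p j
  orient {p = p} P j (inj₁ j≡0) = p , P , cong p (toℕ-injective (sym j≡0))
  orient {k = k} {p} P j (inj₂ 1+j≡1+k) =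
    p ∘ opposite , reverse P , cong p (toℕ-injective (trans (toℕ-fromℕ k) (sym (suc-injective 1+j≡1+k))))

  drop-head : ∀ {N k} {p : Fin (suc k) → Fin n} → IsPathOn G N p → IsPathOn G (λ u → N u × p zero ≢ u) (p ∘ suc)
  drop-head {N} {p = p} P = record
    { injective  = Fin-suc-injective ∘ injective P
    ; within     = λ i → within P (suc i) , Fin-0≢1+n ∘ injective P
    ; onto       = onto′
    ; edge⇒Dist1 = λ i j e → Dist1-suc⁻¹ (edge⇒Dist1 P (suc i) (suc j) e)
    ; Dist1⇒edge = λ i j d → Dist1⇒edge P (suc i) (suc j) (Dist1-suc d)
    }
    where
    onto′ : ∀ u → N u × p zero ≢ u → ∃ λ i → p (suc i) ≡ u
    onto′ u (Nu , p0≢u) with onto P u Nu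
    ... | zero  , eq = ⊥-elim (p0≢u eq)
    ... | suc i , eq = i , eq

  weaken : ∀ {N N′ k} {p : Fin k → Fin n} → (∀ u → N′ u → N u) → (∀ u → N u → N′ u) →
           IsPathOn G N p → IsPathOn G N′ p
  weaken N′⇒N N⇒N′ P = record
    { injective = injective P ; within = λ i → N⇒N′ _ (within P i) ; onto = λ u → onto P u ∘ N′⇒N u
    ; edge⇒Dist1 = edge⇒Dist1 P ; Dist1⇒edge = Dist1⇒edge P }

avoid-two : ∀ {m} → 3 ≤ m → (a b : Fin m) → ∃ λ z → z ≢ a × z ≢ b
avoid-two {suc zero}       (s≤s ())       _ _
avoid-two {suc (suc zero)} (s≤s (s≤s ())) _ _
avoid-two {suc (suc (suc m))} _ a b with zero ≟ᶠ a | zero ≟ᶠ b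
... | no 0≢a   | no 0≢b   = zero , 0≢a , 0≢b
... | yes refl | yes refl = suc zero , (λ ()) , (λ ())
... | yes refl | no _ with suc zero ≟ᶠ b
...   | no 1≢b   = suc zero , (λ ()) , 1≢b
...   | yes refl = suc (suc zero) , (λ ()) , (λ ())
avoid-two {suc (suc (suc m))} _ a b | no _ | yes refl with suc zero ≟ᶠ a
...   | no 1≢a   = suc zero , 1≢a , (λ ())
...   | yes refl = suc (suc zero) , (λ ()) , (λ ())

module _ {n} (G : Graph n) where

  open IsPathOn

  link : LocallyLinear G → ∀ v → PathOn G (Adj G v)
  link LL v = toPathOn G (LL v)

  P₁-neighbours-equal : ∀ {v} {p : Fin 1 → Fin n} → IsPathOn G (Adj G v) p → ∀ {x y} → Adj G v x → Adj G v y → x ≡ y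
  P₁-neighbours-equal P {x} {y} vx vy with onto P x vx | onto P y vy
  ... | zero , refl | zero , refl = refl

  link-len≥2 : 3 ≤ n → Connected G → (LL : LocallyLinear G) → ∀ v → 2 ≤ len G (link LL v)
  link-len≥2 3≤n conn LL v = len≥2 (link LL v)
    where
    no-common-neighbour : ∀ {v} {p : Fin 1 → Fin n} → IsPathOn G (Adj G v) p → ∀ {k w} {q : Fin k → Fin n} →
                          IsPathOn G (Adj G w) q → 2 ≤ k → ¬ Adj G v w
    no-common-neighbour {v} P {w = w} Q 2≤k vw with onto P w vw | onto Q v (Adj-sym G vw)
    ... | zero , refl | j , refl = 1+n≰n (begin
      1                          ≤⟨ pathDeg≥1 j 2≤k ⟩
      pathDeg j                  ≡⟨ LinkProperties.common≡pathDeg G Q j ⟨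
      common G w v               ≡⟨ common-sym G w v ⟩
      common G v w               ≡⟨ LinkProperties.common≡pathDeg G P zero ⟩
      0                          ∎)
      where open ≤-Reasoning
    len≥2 : ∀ {v} → (L : PathOn G (Adj G v)) → 2 ≤ len G L
    len≥2 (suc (suc _) , _) = s≤s (s≤s z≤n)
    len≥2 {v} (1 , _ , p , P) with link LL (p zero)
    ... | suc (suc _) , _ , _ , Q = ⊥-elim (no-common-neighbour P Q (s≤s (s≤s z≤n)) (within P zero))
    ... | 1 , _ , q , Q = ⊥-elim (z∉ (closed (conn v z) (inj₁ refl)))
      where
      w : Fin n
      w = p zero
      vw : Adj G v w
      vw = within P zero
      closed : ∀ {s t} → Reach G s t → s ≡ v ⊎ s ≡ w → t ≡ v ⊎ t ≡ w
      closed here         s∈ = s∈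
      closed (step sx xt) (inj₁ refl) = closed xt (inj₂ (P₁-neighbours-equal P sx vw))
      closed (step sx xt) (inj₂ refl) = closed xt (inj₁ (P₁-neighbours-equal Q sx (Adj-sym G vw)))
      z≢ : ∃ λ z → z ≢ v × z ≢ w
      z≢ = avoid-two 3≤n v w
      z : Fin n
      z = proj₁ z≢
      z∉ : ¬ (z ≡ v ⊎ z ≡ w)
      z∉ (inj₁ eq) = proj₁ (proj₂ z≢) eq
      z∉ (inj₂ eq) = proj₂ (proj₂ z≢) eq

  link-deg≡len : (LL : LocallyLinear G) → ∀ v → deg G v ≡ len G (link LL v)
  link-deg≡len LL v = deg≡len (link LL v)
    where
    deg≡len : (L : PathOn G (Adj G v)) → deg G v ≡ len G L
    deg≡len (_ , _ , _ , P) = LinkProperties.deg≡len G P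

  boundary-triangle⇒deg≡2 : ∀ {c a b} → PathOn G (Adj G c) → a ≢ b →
                            boundary G c a ≡ 1 → boundary G c b ≡ 1 → Adj G a b → deg G c ≡ 2
  boundary-triangle⇒deg≡2 (k , _ , p , P) a≢b ca cb ab
    with common≡1⇒PathEnd (boundary⇒Adj G ca) (boundary⇒common≡1 G ca)
       | common≡1⇒PathEnd (boundary⇒Adj G cb) (boundary⇒common≡1 G cb)
    where open LinkProperties G P
  ... | i , refl , i-end | j , refl , j-end =
    trans (LinkProperties.deg≡len G P) (adjacent-PathEnds i j i-end j-end (a≢b ∘ cong p) (edge⇒Dist1 P i j ab))

  no-three-boundary-neighbours : ∀ {u x y z} → PathOn G (Adj G u) →
                                 boundary G u x ≡ 1 → boundary G u y ≡ 1 → boundary G u z ≡ 1 →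
                                 x ≢ y → x ≢ z → y ≢ z → ⊥
  no-three-boundary-neighbours (_ , _ , p , P) ux uy uz x≢y x≢z y≢z
    with end ux | end uy | end uz
    where
    open LinkProperties G P
    end : ∀ {w} → boundary G _ w ≡ 1 → ∃ λ j → p j ≡ w × PathEnd j
    end uw = common≡1⇒PathEnd (boundary⇒Adj G uw) (boundary⇒common≡1 G uw)
  ... | i , refl , eᵢ | j , refl , eⱼ | l , refl , eₗ =
    no-three-PathEnds eᵢ eⱼ eₗ (x≢y ∘ cong p) (x≢z ∘ cong p) (y≢z ∘ cong p)

  ∑³ : (Fin n → Fin n → Fin n → ℕ) → ℕ
  ∑³ F = ∑[ u < n ] ∑[ w < n ] ∑[ x < n ] F u w x

  ∑³-cong : ∀ {F F′} → (∀ u w x → F u w x ≡ F′ u w x) → ∑³ F ≡ ∑³ F′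
  ∑³-cong eq = sum-cong-≗ {n} λ u → sum-cong-≗ {n} λ w → sum-cong-≗ {n} λ x → eq u w x

  ∑³-mono-≤ : ∀ {F F′} → (∀ u w x → F u w x ≤ F′ u w x) → ∑³ F ≤ ∑³ F′
  ∑³-mono-≤ le = ∑-mono-≤ λ u → ∑-mono-≤ λ w → ∑-mono-≤ λ x → le u w x

  ∑³-distrib-+ : ∀ F F′ → ∑³ (λ u w x → F u w x + F′ u w x) ≡ ∑³ F + ∑³ F′
  ∑³-distrib-+ F F′ = trans (sum-cong-≗ {n} λ u → trans (sum-cong-≗ {n} λ w → ∑-distrib-+ {n} (F u w) (F′ u w))
                                                        (∑-distrib-+ {n} _ _))
                            (∑-distrib-+ {n} _ _)

  ∑³-rotate : ∀ F → ∑³ F ≡ ∑³ (λ w x u → F u w x)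
  ∑³-rotate F = trans (∑-comm {n} {n} λ u w → ∑[ x < n ] F u w x) (sum-cong-≗ {n} λ w → ∑-comm {n} {n} λ u x → F u w x)

  module Counting (LL : LocallyLinear G) (len≥2 : ∀ v → 2 ≤ len G (link LL v)) (no-deg2 : ∀ v → deg G v ≢ 2) where

    link-∑-boundary : ∀ v → ∑[ w < n ] boundary G v w ≡ 2
    link-∑-boundary v = count (link LL v) (len≥2 v)
      where
      count : (L : PathOn G (Adj G v)) → 2 ≤ len G L → ∑[ w < n ] boundary G v w ≡ 2
      count (_ , _ , _ , P) = LinkProperties.∑-boundary-at G P

    link-∑-triangles : ∀ v → ∑[ w < n ] ∑[ x < n ] triangle G v w x ≡ 2 * (deg G v ∸ 1)
    link-∑-triangles v with link LL v
    ... | _ , _ , _ , P = LinkProperties.∑-triangles-at G P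

    tri : Fin n → Fin n → Fin n → ℕ
    tri = triangle G

    β : Fin n → Fin n → ℕ
    β = boundary G

    one-boundary-per-triangle : ∀ u w x → tri u w x * (β u w + β w x + β x u) ≤ tri u w x
    one-boundary-per-triangle u w x with A≡0⊎Adj G u w | A≡0⊎Adj G w x | A≡0⊎Adj G x u
    ... | inj₁ A≡0 | _ | _ rewrite A≡0 = z≤n
    ... | inj₂ _ | inj₁ A≡0 | _ rewrite A≡0 | *-zeroʳ (A G u w) = z≤n
    ... | inj₂ _ | inj₂ _ | inj₁ A≡0 rewrite A≡0 | *-zeroʳ (A G u w * A G w x) = z≤n
    ... | inj₂ uw | inj₂ wx | inj₂ xu =
      subst (λ t → t * (β u w + β w x + β x u) ≤ t) (sym tri≡1) (subst (_≤ 1) (sym (+-identityʳ _))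
        (at-most-one (β u w) (β w x) (β x u)
        (boundary≡0⊎1 G u w) (boundary≡0⊎1 G w x) (boundary≡0⊎1 G x u)
        (not-two w u x (Adj-sym G xu)) (not-two x w u (Adj-sym G uw)) (not-two u x w (Adj-sym G wx))))
      where
      tri≡1 : tri u w x ≡ 1
      tri≡1 = cong₂ _*_ (cong₂ _*_ (Adj⇒A≡1 G uw) (Adj⇒A≡1 G wx)) (Adj⇒A≡1 G xu)
      not-two : ∀ c a b → Adj G a b → β a c ≡ 1 → β c b ≡ 1 → ⊥
      not-two c a b ab ac cb = no-deg2 c (boundary-triangle⇒deg≡2 (link LL c) (Adj⇒≢ G ab) (trans (boundary-sym G c a) ac) cb ab)
      at-most-one : ∀ a b c → a ≡ 0 ⊎ a ≡ 1 → b ≡ 0 ⊎ b ≡ 1 → c ≡ 0 ⊎ c ≡ 1 →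
                    (a ≡ 1 → b ≡ 1 → ⊥) → (b ≡ 1 → c ≡ 1 → ⊥) → (c ≡ 1 → a ≡ 1 → ⊥) → a + b + c ≤ 1
      at-most-one _ _ _ (inj₁ refl) (inj₁ refl) (inj₁ refl) _ _ _ = z≤n
      at-most-one _ _ _ (inj₂ refl) (inj₁ refl) (inj₁ refl) _ _ _ = ≤-refl
      at-most-one _ _ _ (inj₁ refl) (inj₂ refl) (inj₁ refl) _ _ _ = ≤-refl
      at-most-one _ _ _ (inj₁ refl) (inj₁ refl) (inj₂ refl) _ _ _ = ≤-refl
      at-most-one _ _ _ (inj₂ refl) (inj₂ refl) _ ab _ _ = ⊥-elim (ab refl refl)
      at-most-one _ _ _ _ (inj₂ refl) (inj₂ refl) _ bc _ = ⊥-elim (bc refl refl)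
      at-most-one _ _ _ (inj₂ refl) _ (inj₂ refl) _ _ ca = ⊥-elim (ca refl refl)

    ∑-triangles-on-boundary₁ : ∑³ (λ u w x → tri u w x * β u w) ≡ n * 2
    ∑-triangles-on-boundary₁ = begin
      ∑³ (λ u w x → tri u w x * β u w)  ≡⟨ sum-cong-≗ {n} (λ u → sum-cong-≗ {n} (per-edge u)) ⟩
      ∑[ u < n ] ∑[ w < n ] β u w       ≡⟨ sum-cong-≗ {n} link-∑-boundary ⟩
      ∑[ u < n ] 2                      ≡⟨ ∑-const n 2 ⟩
      n * 2                             ∎
      where
      open ≡-Reasoning
      per-edge : ∀ u w → ∑[ x < n ] (tri u w x * β u w) ≡ β u w
      per-edge u w = begin
        ∑[ x < n ] (tri u w x * β u w)    ≡⟨ sum-cong-≗ {n} (λ x → *-comm (tri u w x) (β u w)) ⟩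
        ∑[ x < n ] (β u w * tri u w x)    ≡⟨ *-distribˡ-sum (β u w) (tri u w) ⟨
        β u w * ∑[ x < n ] tri u w x      ≡⟨ cong (β u w *_) (∑-triangle G u w) ⟩
        β u w * (A G u w * common G u w)  ≡⟨ *-comm (β u w) _ ⟩
        A G u w * common G u w * β u w    ≡⟨ triangles-on-boundary G u w ⟩
        β u w                             ∎

    ∑-triangles-on-boundary₂ : ∑³ (λ u w x → tri u w x * β w x) ≡ n * 2
    ∑-triangles-on-boundary₂ = begin
      ∑³ (λ u w x → tri u w x * β w x)  ≡⟨ ∑³-rotate _ ⟩
      ∑³ (λ w x u → tri u w x * β w x)  ≡⟨ ∑³-cong (λ w x u → cong (_* β w x) (triangle-rotate G u w x)) ⟩
      ∑³ (λ w x u → tri w x u * β w x)  ≡⟨ ∑-triangles-on-boundary₁ ⟩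
      n * 2                             ∎
      where open ≡-Reasoning

    ∑-triangles-on-boundary₃ : ∑³ (λ u w x → tri u w x * β x u) ≡ n * 2
    ∑-triangles-on-boundary₃ = begin
      ∑³ (λ u w x → tri u w x * β x u)  ≡⟨ ∑³-rotate _ ⟩
      ∑³ (λ w x u → tri u w x * β x u)  ≡⟨ ∑³-rotate _ ⟩
      ∑³ (λ x u w → tri u w x * β x u)  ≡⟨ ∑³-cong (λ x u w → cong (_* β x u) (triangle-rotate G x u w)) ⟨
      ∑³ (λ x u w → tri x u w * β x u)  ≡⟨ ∑-triangles-on-boundary₁ ⟩
      n * 2                             ∎
      where open ≡-Reasoning

    6n≤∑-triangles : 3 * (n * 2) ≤ ∑[ u < n ] (2 * (deg G u ∸ 1))
    6n≤∑-triangles = begin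
      3 * (n * 2)                       ≡⟨ cong (n * 2 +_) (cong (n * 2 +_) (+-identityʳ (n * 2))) ⟩
      n * 2 + (n * 2 + n * 2)           ≡⟨ +-assoc (n * 2) _ _ ⟨
      n * 2 + n * 2 + n * 2
        ≡⟨ cong₂ _+_ (cong₂ _+_ ∑-triangles-on-boundary₁ ∑-triangles-on-boundary₂) ∑-triangles-on-boundary₃ ⟨
      ∑³ (λ u w x → tri u w x * β u w) + ∑³ (λ u w x → tri u w x * β w x) + ∑³ (λ u w x → tri u w x * β x u)
                                        ≡⟨ cong (_+ ∑³ (λ u w x → tri u w x * β x u)) (∑³-distrib-+ _ _) ⟨
      ∑³ (λ u w x → tri u w x * β u w + tri u w x * β w x) + ∑³ (λ u w x → tri u w x * β x u)
                                        ≡⟨ ∑³-distrib-+ _ _ ⟨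
      ∑³ (λ u w x → tri u w x * β u w + tri u w x * β w x + tri u w x * β x u)
                                        ≡⟨ ∑³-cong (λ u w x → distrib₃ (tri u w x) _ _ _) ⟨
      ∑³ (λ u w x → tri u w x * (β u w + β w x + β x u))
                                        ≤⟨ ∑³-mono-≤ one-boundary-per-triangle ⟩
      ∑³ tri                            ≡⟨ sum-cong-≗ {n} link-∑-triangles ⟩
      ∑[ u < n ] (2 * (deg G u ∸ 1))    ∎
      where
      open ≤-Reasoning
      distrib₃ : ∀ t a b c → t * (a + b + c) ≡ t * a + t * b + t * c
      distrib₃ t a b c = trans (*-distribˡ-+ t (a + b) c) (cong (_+ t * c) (*-distribˡ-+ t a b))

    ∑-triangles+2n : ∑[ u < n ] (2 * (deg G u ∸ 1)) + n * 2 ≡ 2 * (2 * size G)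
    ∑-triangles+2n = begin
      ∑[ u < n ] (2 * (deg G u ∸ 1)) + n * 2             ≡⟨ cong (∑[ u < n ] (2 * (deg G u ∸ 1)) +_) (∑-const n 2) ⟨
      ∑[ u < n ] (2 * (deg G u ∸ 1)) + ∑[ u < n ] 2      ≡⟨ ∑-distrib-+ {n} _ _ ⟨
      ∑[ u < n ] (2 * (deg G u ∸ 1) + 2)                 ≡⟨ sum-cong-≗ {n} (λ u → double-pred (deg G u) (deg≥1 u)) ⟩
      ∑[ u < n ] (2 * deg G u)                           ≡⟨ *-distribˡ-sum 2 (deg G) ⟨
      2 * ∑[ u < n ] deg G u                             ≡⟨ cong (2 *_) (handshake G) ⟩
      2 * (2 * size G)                                   ∎
      where
      open ≡-Reasoning
      deg≥1 : ∀ u → 1 ≤ deg G u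
      deg≥1 u = subst (1 ≤_) (sym (link-deg≡len LL u)) (≤-trans (s≤s z≤n) (len≥2 u))
      double-pred : ∀ d → 1 ≤ d → 2 * (d ∸ 1) + 2 ≡ 2 * d
      double-pred (suc d) _ = trans (+-comm (2 * d) 2) (sym (*-suc 2 d))

    2n≤size : 2 * n ≤ size G
    2n≤size = *-cancelˡ-≤ 4 (begin
      4 * (2 * n)                                 ≡⟨ +-comm (2 * n) (3 * (2 * n)) ⟩
      3 * (2 * n) + 2 * n                         ≡⟨ cong (λ m → 3 * m + m) (*-comm 2 n) ⟩
      3 * (n * 2) + n * 2                         ≤⟨ +-monoˡ-≤ (n * 2) 6n≤∑-triangles ⟩
      ∑[ u < n ] (2 * (deg G u ∸ 1)) + n * 2      ≡⟨ ∑-triangles+2n ⟩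
      2 * (2 * size G)                            ≡⟨ *-assoc 2 2 (size G) ⟨
      4 * size G                                  ∎)
      where open ≤-Reasoning

-- Deleting a vertex of degree two
del : ∀ {m} → Graph (suc m) → Fin (suc m) → Graph m
del G v = record
  { adj   = λ i j → adj G (punchIn v i) (punchIn v j)
  ; sym   = λ i j → adj-sym G (punchIn v i) (punchIn v j)
  ; irref = λ i → irref G (punchIn v i)
  }

punchIn-onto : ∀ {m} (v w : Fin (suc m)) → v ≢ w → ∃ λ w′ → punchIn v w′ ≡ w
punchIn-onto v w v≢w = punchOut v≢w , punchIn-punchOut v≢w

module Deletion {m} (G : Graph (suc m)) (v : Fin (suc m)) where

  open IsPathOn

  D : Graph m
  D = del G v

  ι : Fin m → Fin (suc m)
  ι = punchIn v

  pullback : ∀ {N k} {p : Fin k → Fin (suc m)} → IsPathOn G N p → (avoid : ∀ i → v ≢ p i) →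
             IsPathOn D (N ∘ ι) (λ i → punchOut (avoid i))
  pullback {N} {k} {p} P avoid = record
    { injective  = λ {i} {j} eq → injective P (trans (sym (back i)) (trans (cong ι eq) (back j)))
    ; within     = λ i → subst N (sym (back i)) (within P i)
    ; onto       = onto′
    ; edge⇒Dist1 = λ i j e → edge⇒Dist1 P i j (subst₂ (Adj G) (back i) (back j) e)
    ; Dist1⇒edge = λ i j d → subst₂ (Adj G) (sym (back i)) (sym (back j)) (Dist1⇒edge P i j d)
    }
    where
    back : ∀ i → ι (punchOut (avoid i)) ≡ p i
    back i = punchIn-punchOut (avoid i)
    onto′ : ∀ w → N (ι w) → ∃ λ i → punchOut (avoid i) ≡ w
    onto′ w Nw with onto P (ι w) Nw
    ... | i , pi≡ιw = i , punchIn-injective v _ _ (trans (back i) pi≡ιw)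

  Simplicial : Set
  Simplicial = ∀ {a b} → Adj G v a → Adj G v b → a ≢ b → Adj G a b

  Reach-del : Simplicial → ∀ {s t} → Reach G s t → ∀ {x y} → ι x ≡ s → ι y ≡ t → Reach D x y
  Reach-del simp here {x} {y} ιx≡s ιy≡t = subst (Reach D x) (punchIn-injective v _ _ (trans ιx≡s (sym ιy≡t))) here
  Reach-del simp (step {w = w} sw wt) ιx≡s ιy≡t with v ≟ᶠ w
  ... | no v≢w = let (w′ , ιw′≡w) = punchIn-onto v w v≢w in
    step (subst₂ (Adj G) (sym ιx≡s) (sym ιw′≡w) sw) (Reach-del simp wt ιw′≡w ιy≡t)
  Reach-del simp (step sw here) {y = y} ιx≡s ιy≡t | yes refl = ⊥-elim (punchInᵢ≢i v y ιy≡t)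
  Reach-del simp (step {s} sw (step {w = w₂} vw₂ w₂t)) {x} ιx≡s ιy≡t | yes refl with s ≟ᶠ w₂
  ... | yes refl = Reach-del simp w₂t ιx≡s ιy≡t
  ... | no s≢w₂  = let (w₂′ , ιw₂′≡w₂) = punchIn-onto v w₂ (Adj⇒≢ G vw₂) in
    step (subst₂ (Adj G) (sym ιx≡s) (sym ιw₂′≡w₂) (simp (Adj-sym G sw) vw₂ s≢w₂))
         (Reach-del simp w₂t ιw₂′≡w₂ ιy≡t)

  Connected-del : Simplicial → Connected G → Connected D
  Connected-del simp conn x y = Reach-del simp (conn (ι x) (ι y)) refl refl

  deg-del : ∀ x → deg G (ι x) ≡ A G (ι x) v + deg D x
  deg-del x = sum-remove {i = v} (A G (ι x))

  size-del : size G ≡ deg G v + size D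
  size-del = *-cancelˡ-≡ (size G) (deg G v + size D) 2 (begin
    2 * size G                                             ≡⟨ handshake G ⟨
    ∑[ u < suc m ] deg G u                                 ≡⟨ sum-remove {i = v} (deg G) ⟩
    deg G v + ∑[ x < m ] deg G (ι x)                       ≡⟨ cong (deg G v +_) (sum-cong-≗ {m} deg-del) ⟩
    deg G v + ∑[ x < m ] (A G (ι x) v + deg D x)           ≡⟨ cong (deg G v +_) (∑-distrib-+ {m} _ _) ⟩
    deg G v + (∑[ x < m ] A G (ι x) v + ∑[ x < m ] deg D x) ≡⟨ cong (λ t → deg G v + (t + ∑[ x < m ] deg D x)) column ⟩
    deg G v + (deg G v + ∑[ x < m ] deg D x)               ≡⟨ cong (λ t → deg G v + (deg G v + t)) (handshake D) ⟩
    deg G v + (deg G v + 2 * size D)                       ≡⟨ +-assoc (deg G v) (deg G v) _ ⟨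
    (deg G v + deg G v) + 2 * size D                       ≡⟨ cong (_+ 2 * size D) (cong (deg G v +_) (+-identityʳ (deg G v))) ⟨
    2 * deg G v + 2 * size D                               ≡⟨ *-distribˡ-+ 2 (deg G v) (size D) ⟨
    2 * (deg G v + size D)                                 ∎)
    where
    open ≡-Reasoning
    column : ∑[ x < m ] A G (ι x) v ≡ deg G v
    column = begin
      ∑[ x < m ] A G (ι x) v              ≡⟨ cong (_+ ∑[ x < m ] A G (ι x) v) (A-irrefl G v) ⟨
      A G v v + ∑[ x < m ] A G (ι x) v    ≡⟨ sum-remove {i = v} (λ u → A G u v) ⟨
      ∑[ u < suc m ] A G u v              ≡⟨ sum-cong-≗ {suc m} (λ u → A-sym G u v) ⟩
      deg G v                             ∎

  common-del : ∀ x y → common G (ι x) (ι y) ≡ A G (ι x) v * A G (ι y) v + common D x y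
  common-del x y = sum-remove {i = v} (λ z → A G (ι x) z * A G (ι y) z)

  boundary-del : ∀ x y → A G (ι x) v * A G (ι y) v ≡ 0 → boundary G (ι x) (ι y) ≡ boundary D x y
  boundary-del x y not-both =
    cong (λ c → A G (ι x) (ι y) * 𝟙 (c ≡ᵇ 1)) (trans (common-del x y) (cong (_+ common D x y) not-both))

module DegreeTwo {m} (G : Graph (suc m)) (v : Fin (suc m)) {p : Fin 2 → Fin (suc m)} (P : IsPathOn G (Adj G v) p) where

  open IsPathOn
  open Deletion G v

  a b : Fin (suc m)
  a = p zero
  b = p (suc zero)

  ab : Adj G a b
  ab = Dist1⇒edge P zero (suc zero) (inj₁ refl)

  neighbours : ∀ {x} → Adj G v x → x ≡ a ⊎ x ≡ b
  neighbours {x} vx with onto P x vx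
  ... | zero     , eq = inj₁ (sym eq)
  ... | suc zero , eq = inj₂ (sym eq)

  simplicial : Simplicial
  simplicial va vb a≢b with neighbours va | neighbours vb
  ... | inj₁ refl | inj₁ refl = ⊥-elim (a≢b refl)
  ... | inj₁ refl | inj₂ refl = ab
  ... | inj₂ refl | inj₁ refl = Adj-sym G ab
  ... | inj₂ refl | inj₂ refl = ⊥-elim (a≢b refl)

  common-at-v : ∀ {s} → Adj G v s → common G s v ≡ 1
  common-at-v {s} vs = begin
    common G s v             ≡⟨ common-sym G s v ⟩
    common G v s             ≡⟨ LinkProperties.∑-over-link G P (A G s) ⟩
    A G s a + (A G s b + 0)  ≡⟨ cong (A G s a +_) (+-identityʳ (A G s b)) ⟩
    A G s a + A G s b        ≡⟨ one-of (neighbours vs) ⟩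
    1                        ∎
    where
    open ≡-Reasoning
    one-of : s ≡ a ⊎ s ≡ b → A G s a + A G s b ≡ 1
    one-of (inj₁ refl) = cong₂ _+_ (A-irrefl G a) (Adj⇒A≡1 G ab)
    one-of (inj₂ refl) = cong₂ _+_ (Adj⇒A≡1 G (Adj-sym G ab)) (A-irrefl G b)

  boundary-at-v : ∀ {s} → Adj G v s → boundary G v s ≡ 1
  boundary-at-v vs = boundary-intro G vs (trans (common-sym G _ _) (common-at-v vs))

  link-del : ∀ i (L : PathOn G (Adj G (ι i))) → 2 ≤ len G L → PathOn D (Adj D i)
  link-del i (suc (suc k) , k≥1 , q , Q) _ with adj G (ι i) v in ιi~v
  ... | false = suc (suc k) , k≥1 , _ , pullback Q avoid
    where
    avoid : ∀ j → v ≢ q j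
    avoid j v≡qj with trans (sym (within Q j)) (trans (cong (adj G (ι i)) (sym v≡qj)) ιi~v)
    ... | ()
  ... | true with LinkProperties.common≡1⇒PathEnd G Q ιi~v (common-at-v (Adj-sym G ιi~v))
  ...   | j , qj≡v , end with orient G Q j end
  ...     | q′ , Q′ , q′0≡qj = suc k , s≤s z≤n , _ ,
    weaken D (λ w ιi~ιw → ιi~ιw , λ eq → punchInᵢ≢i v w (trans (sym eq) (sym v≡q′0))) (λ _ → proj₁)
             (pullback (drop-head G Q′) avoid)
    where
    v≡q′0 : v ≡ q′ zero
    v≡q′0 = sym (trans q′0≡qj qj≡v)
    avoid : ∀ j → v ≢ q′ (suc j)
    avoid j v≡q′j = proj₂ (within (drop-head G Q′) j) (trans (sym v≡q′0) v≡q′j)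
  link-del i (1 , _) (s≤s ())

-- Hamiltonian cycles
HamCycle : ∀ {n} → (Fin n → Fin n → Set) → Set
HamCycle {n} R = Σ (Fin n → Fin n) λ f → Injective _≡_ _≡_ f × (∀ i → R (f i) (f (cyc i)))

cyc-toℕ : ∀ {n} (i : Fin (suc n)) → (toℕ i < n × toℕ (cyc i) ≡ suc (toℕ i)) ⊎ (toℕ i ≡ n × cyc i ≡ zero)
cyc-toℕ {n} i with suc (toℕ i) <? suc n
... | yes 1+i<1+n = inj₁ (s≤s⁻¹ 1+i<1+n , toℕ-fromℕ< 1+i<1+n)
... | no  1+i≮1+n = inj₂ (≤-antisym (s≤s⁻¹ (toℕ<n i)) (≮⇒≥ (1+i≮1+n ∘ s≤s)) , refl)

cyc-< : ∀ {n} (i : Fin (suc n)) → toℕ i < n → toℕ (cyc i) ≡ suc (toℕ i)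
cyc-< i i<n with cyc-toℕ i
... | inj₁ (_ , eq)  = eq
... | inj₂ (i≡n , _) = ⊥-elim (<-irrefl i≡n i<n)

cyc-last : ∀ n → cyc (fromℕ n) ≡ zero
cyc-last n with cyc-toℕ (fromℕ n)
... | inj₁ (n<n , _) = ⊥-elim (<-irrefl (toℕ-fromℕ n) n<n)
... | inj₂ (_ , eq)  = eq

cyc-injective : ∀ {n} → Injective _≡_ _≡_ (cyc {n})
cyc-injective {suc n} {i} {j} eq with cyc-toℕ i | cyc-toℕ j
... | inj₁ (_ , eqᵢ) | inj₁ (_ , eqⱼ) = toℕ-injective (suc-injective (trans (sym eqᵢ) (trans (cong toℕ eq) eqⱼ)))
... | inj₂ (i≡n , _) | inj₂ (j≡n , _) = toℕ-injective (trans i≡n (sym j≡n))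
... | inj₁ (_ , eqᵢ) | inj₂ (_ , cj≡0) = ⊥-elim (1+n≢0 (trans (sym eqᵢ) (cong toℕ (trans eq cj≡0))))
... | inj₂ (_ , ci≡0) | inj₁ (_ , eqⱼ) = ⊥-elim (1+n≢0 (trans (sym eqⱼ) (cong toℕ (trans (sym eq) ci≡0))))

cyc^ : ∀ {n} → ℕ → Fin n → Fin n
cyc^ zero    x = x
cyc^ (suc r) x = cyc (cyc^ r x)

cyc^-cyc : ∀ {n} r (x : Fin n) → cyc^ r (cyc x) ≡ cyc (cyc^ r x)
cyc^-cyc zero    x = refl
cyc^-cyc (suc r) x = cong cyc (cyc^-cyc r x)

cyc^-+ : ∀ {n} r s (x : Fin n) → cyc^ (r + s) x ≡ cyc^ r (cyc^ s x)
cyc^-+ zero    s x = refl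
cyc^-+ (suc r) s x = cong cyc (cyc^-+ r s x)

cyc^-injective : ∀ {n} r → Injective _≡_ _≡_ (cyc^ {n} r)
cyc^-injective zero    eq = eq
cyc^-injective (suc r) eq = cyc^-injective r (cyc-injective eq)

toℕ-cyc^ : ∀ {n} r (i : Fin (suc n)) → toℕ i + r ≤ n → toℕ (cyc^ r i) ≡ toℕ i + r
toℕ-cyc^ zero    i _ = sym (+-identityʳ (toℕ i))
toℕ-cyc^ {n} (suc r) i i+1+r≤n = begin
  toℕ (cyc (cyc^ r i))   ≡⟨ cyc-< (cyc^ r i) (subst (_< n) (sym ih) (subst (_≤ n) (+-suc (toℕ i) r) i+1+r≤n)) ⟩
  suc (toℕ (cyc^ r i))   ≡⟨ cong suc ih ⟩
  suc (toℕ i + r)        ≡⟨ +-suc (toℕ i) r ⟨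
  toℕ i + suc r          ∎
  where
  open ≡-Reasoning
  ih : toℕ (cyc^ r i) ≡ toℕ i + r
  ih = toℕ-cyc^ r i (≤-trans (+-monoʳ-≤ (toℕ i) (n≤1+n r)) i+1+r≤n)

cyc^-reaches : ∀ {n} (i j : Fin n) → ∃ λ r → cyc^ r i ≡ j
cyc^-reaches {suc n} i j = toℕ j + suc (n ∸ toℕ i) , (begin
  cyc^ (toℕ j + suc (n ∸ toℕ i)) i       ≡⟨ cyc^-+ (toℕ j) _ i ⟩
  cyc^ (toℕ j) (cyc (cyc^ (n ∸ toℕ i) i)) ≡⟨ cong (cyc^ (toℕ j)) to-zero ⟩
  cyc^ (toℕ j) zero                      ≡⟨ toℕ-injective (toℕ-cyc^ (toℕ j) zero (s≤s⁻¹ (toℕ<n j))) ⟩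
  j                                      ∎)
  where
  open ≡-Reasoning
  i≤n : toℕ i ≤ n
  i≤n = s≤s⁻¹ (toℕ<n i)
  to-last : cyc^ (n ∸ toℕ i) i ≡ fromℕ n
  to-last = toℕ-injective (trans (toℕ-cyc^ (n ∸ toℕ i) i (≤-reflexive (m+[n∸m]≡n i≤n)))
                                 (trans (m+[n∸m]≡n i≤n) (sym (toℕ-fromℕ n))))
  to-zero : cyc (cyc^ (n ∸ toℕ i) i) ≡ zero
  to-zero = trans (cong cyc to-last) (cyc-last n)

cyc-surjective : ∀ {n} (i : Fin n) → ∃ λ j → cyc j ≡ i
cyc-surjective i with cyc^-reaches (cyc i) i
... | r , eq = cyc^ r i , trans (sym (cyc^-cyc r i)) eq

cyc²≢id : ∀ {n} (j : Fin n) → 3 ≤ n → cyc (cyc j) ≢ j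
cyc²≢id {suc n} j (s≤s 2≤n) eq with cyc-toℕ j
... | inj₂ (j≡n , cj≡0) = <-irrefl (begin
  1                     ≡⟨ cyc-< zero (≤-trans (s≤s z≤n) 2≤n) ⟨
  toℕ (cyc zero)        ≡⟨ cong (toℕ ∘ cyc) cj≡0 ⟨
  toℕ (cyc (cyc j))     ≡⟨ cong toℕ eq ⟩
  toℕ j                 ≡⟨ j≡n ⟩
  n                     ∎) 2≤n
  where open ≡-Reasoning
... | inj₁ (_ , eq₁) with cyc-toℕ (cyc j)
...   | inj₁ (_ , eq₂) = m+1+n≢n 1 (trans (sym (trans eq₂ (cong suc eq₁))) (cong toℕ eq))
...   | inj₂ (cj≡n , ccj≡0) = <-irrefl (begin
  1                     ≡⟨ cong (suc ∘ toℕ) (trans (sym eq) ccj≡0) ⟨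
  suc (toℕ j)           ≡⟨ eq₁ ⟨
  toℕ (cyc j)           ≡⟨ cj≡n ⟩
  n                     ∎) 2≤n
  where open ≡-Reasoning

injective⇒surjective : ∀ {n} (f : Fin n → Fin n) → Injective _≡_ _≡_ f → ∀ y → ∃ λ x → f x ≡ y
injective⇒surjective {suc n} f f-inj y with any? (λ x → f x ≟ᶠ y)
... | yes hit  = hit
... | no  miss = ⊥-elim (<-irrefl refl (injective⇒≤ g-inj))
  where
  y≢f : ∀ x → y ≢ f x
  y≢f x eq = miss (x , sym eq)
  g : Fin (suc n) → Fin n
  g x = punchOut (y≢f x)
  g-inj : Injective _≡_ _≡_ g
  g-inj eq = f-inj (punchOut-injective (y≢f _) (y≢f _) eq)

rotate : ∀ {k} {R : Fin (suc k) → Fin (suc k) → Set} ((f , _) : HamCycle R) → ∀ s →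
         Σ (HamCycle R) λ (g , _) → g (fromℕ k) ≡ f s × g zero ≡ f (cyc s)
rotate {k} {R} (f , f-inj , f-R) s with cyc^-reaches (fromℕ k) s
... | r , last↦s = (f ∘ cyc^ r , f-inj′ , f-R′) , cong f last↦s , cong f (begin
  cyc^ r zero             ≡⟨ cong (cyc^ r) (cyc-last k) ⟨
  cyc^ r (cyc (fromℕ k))  ≡⟨ cyc^-cyc r (fromℕ k) ⟩
  cyc (cyc^ r (fromℕ k))  ≡⟨ cong cyc last↦s ⟩
  cyc s                   ∎)
  where
  open ≡-Reasoning
  f-inj′ : Injective _≡_ _≡_ (f ∘ cyc^ r)
  f-inj′ = cyc^-injective r ∘ f-inj
  f-R′ : ∀ i → R (f (cyc^ r i)) (f (cyc^ r (cyc i)))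
  f-R′ i = subst (R (f (cyc^ r i)) ∘ f) (sym (cyc^-cyc r i)) (f-R (cyc^ r i))

cyc-zero : ∀ {k} → cyc {suc (suc k)} zero ≡ suc zero
cyc-zero {k} = toℕ-injective (cyc-< {suc k} zero (s≤s z≤n))

cyc-suc : ∀ {k} (x : Fin (suc k)) → toℕ x < k → cyc (suc x) ≡ suc (cyc x)
cyc-suc x x<k = toℕ-injective (trans (cyc-< (suc x) (s≤s x<k)) (cong suc (sym (cyc-< x x<k))))

HamCycle-insert : ∀ {k} {S : Fin (suc (suc k)) → Fin (suc (suc k)) → Set} (v : Fin (suc (suc k)))
                  (g : Fin (suc k) → Fin (suc k)) → Injective _≡_ _≡_ g →
                  (∀ x → toℕ x < k → S (punchIn v (g x)) (punchIn v (g (cyc x)))) →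
                  S (punchIn v (g (fromℕ k))) v → S v (punchIn v (g zero)) → HamCycle S
HamCycle-insert {k} {S} v g g-inj S-inner S-last S-first = f , f-inj , f-S
  where
  f : Fin (suc (suc k)) → Fin (suc (suc k))
  f zero    = v
  f (suc x) = punchIn v (g x)
  f-inj : Injective _≡_ _≡_ f
  f-inj {zero}  {zero}  _  = refl
  f-inj {zero}  {suc y} eq = ⊥-elim (punchInᵢ≢i v (g y) (sym eq))
  f-inj {suc x} {zero}  eq = ⊥-elim (punchInᵢ≢i v (g x) eq)
  f-inj {suc x} {suc y} eq = cong suc (g-inj (punchIn-injective v _ _ eq))
  f-S : ∀ i → S (f i) (f (cyc i))
  f-S zero = subst (S v ∘ f) (sym cyc-zero) S-first
  f-S (suc x) with toℕ x <? k
  ... | yes x<k = subst (S (f (suc x)) ∘ f) (sym (cyc-suc x x<k)) (S-inner x x<k)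
  ... | no  x≮k
    rewrite toℕ-injective {i = x} {j = fromℕ k} (trans (≤-antisym (s≤s⁻¹ (toℕ<n x)) (≮⇒≥ x≮k)) (sym (toℕ-fromℕ k))) =
    subst (S (f (suc (fromℕ k))) ∘ f) (sym (cyc-last (suc k))) S-last

-- The lower bound
BoundaryHamiltonian : ∀ {n} → Graph n → Set
BoundaryHamiltonian {n} G = 3 ≤ n × HamCycle (λ u w → boundary G u w ≡ 1)

BoundaryHamiltonian⇒Hamiltonian : ∀ {n} (G : Graph n) → BoundaryHamiltonian G → Hamiltonian G
BoundaryHamiltonian⇒Hamiltonian G (3≤n , f , f-inj , f-boundary) = 3≤n , f , f-inj , boundary⇒Adj G ∘ f-boundary

module Insertion {k} (G : Graph (suc (suc k))) (LL : LocallyLinear G) (conn : Connected G) (3≤1+k : 3 ≤ suc k)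
                 (v : Fin (suc (suc k))) {p : Fin 2 → Fin (suc (suc k))} (P : IsPathOn G (Adj G v) p) where

  open IsPathOn
  open Deletion G v
  open DegreeTwo G v P

  LL-D : LocallyLinear D
  LL-D i = fromPathOn D (link-del i (link G LL (ι i)) (link-len≥2 G (m≤n⇒m≤1+n 3≤1+k) conn LL (ι i)))

  conn-D : Connected D
  conn-D = Connected-del simplicial conn

  va : Adj G v a
  va = within P zero

  vb : Adj G v b
  vb = within P (suc zero)

  v≢a : v ≢ a
  v≢a = Adj⇒≢ G va

  v≢b : v ≢ b
  v≢b = Adj⇒≢ G vb

  a′ b′ : Fin (suc k)
  a′ = punchOut v≢a
  b′ = punchOut v≢b

  ιa′≡a : ι a′ ≡ a
  ιa′≡a = punchIn-punchOut v≢a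

  ιb′≡b : ι b′ ≡ b
  ιb′≡b = punchIn-punchOut v≢b

  deg-a≥3 : 3 ≤ deg G a
  deg-a≥3 = begin
    3                          ≤⟨ s≤s (link-len≥2 D 3≤1+k conn-D LL-D a′) ⟩
    1 + len D (link D LL-D a′) ≡⟨ cong suc (link-deg≡len D LL-D a′) ⟨
    1 + deg D a′               ≡⟨ cong (_+ deg D a′) (Adj⇒A≡1 G (subst (λ t → Adj G t v) (sym ιa′≡a) (Adj-sym G va))) ⟨
    A G (ι a′) v + deg D a′    ≡⟨ deg-del a′ ⟨
    deg G (ι a′)               ≡⟨ cong (deg G) ιa′≡a ⟩
    deg G a                    ∎
    where open ≤-Reasoning

  common-ab≡2 : common G a b ≡ 2
  common-ab≡2 = from-link (link G LL a) (link-deg≡len G LL a)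
    where
    from-link : (L : PathOn G (Adj G a)) → deg G a ≡ len G L → common G a b ≡ 2
    from-link (_ , _ , q , Q) deg≡len
      with LinkProperties.common≡1⇒PathEnd G Q (Adj-sym G va) (common-at-v va) | onto Q b ab
    ... | j₀ , qj₀≡v , j₀-end | j , qj≡b = begin
      common G a b      ≡⟨ cong (common G a) qj≡b ⟨
      common G a (q j)  ≡⟨ LinkProperties.common≡pathDeg G Q j ⟩
      pathDeg j         ≡⟨ PathEnd-neighbour j₀ j (subst (3 ≤_) deg≡len deg-a≥3) j₀-end
                               (edge⇒Dist1 Q j₀ j (subst₂ (Adj G) (sym qj₀≡v) (sym qj≡b) vb)) ⟩
      2                 ∎
      where open ≡-Reasoning

  boundary-a′b′ : boundary D a′ b′ ≡ 1
  boundary-a′b′ = boundary-intro D (subst₂ (Adj G) (sym ιa′≡a) (sym ιb′≡b) ab) (suc-injective (begin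
    suc (common D a′ b′)
      ≡⟨ cong (_+ common D a′ b′) (cong₂ _*_ (A-v a′ ιa′≡a va) (A-v b′ ιb′≡b vb)) ⟨
    A G (ι a′) v * A G (ι b′) v + common D a′ b′ ≡⟨ common-del a′ b′ ⟨
    common G (ι a′) (ι b′)                       ≡⟨ cong₂ (common G) ιa′≡a ιb′≡b ⟩
    common G a b                                 ≡⟨ common-ab≡2 ⟩
    2                                            ∎))
    where
    open ≡-Reasoning
    A-v : ∀ x {s} → ι x ≡ s → Adj G v s → A G (ι x) v ≡ 1
    A-v x refl vs = Adj⇒A≡1 G (Adj-sym G vs)

  IsPair : Fin (suc k) → Fin (suc k) → Set
  IsPair x y = (x ≡ a′ × y ≡ b′) ⊎ (x ≡ b′ × y ≡ a′)

  consecutive-a′b′ : ((f , _) : HamCycle (λ x y → boundary D x y ≡ 1)) → ∃ λ s → IsPair (f s) (f (cyc s))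
  consecutive-a′b′ (f , f-inj , f-boundary) with injective⇒surjective f f-inj a′
  ... | i , fi≡a′ with cyc-surjective i
  ... | j , cj≡i with f (cyc i) ≟ᶠ b′ | f j ≟ᶠ b′
  ... | yes next≡b′ | _          = i , inj₁ (fi≡a′ , next≡b′)
  ... | no _        | yes prev≡b′ = j , inj₂ (prev≡b′ , trans (cong f cj≡i) fi≡a′)
  ... | no next≢b′  | no prev≢b′  =
    ⊥-elim (no-three-boundary-neighbours D (link D LL-D a′) to-prev to-next boundary-a′b′ prev≢next prev≢b′ next≢b′)
    where
    to-next : boundary D a′ (f (cyc i)) ≡ 1
    to-next = subst (λ t → boundary D t (f (cyc i)) ≡ 1) fi≡a′ (f-boundary i)
    to-prev : boundary D a′ (f j) ≡ 1
    to-prev = trans (boundary-sym D a′ (f j)) (subst (λ t → boundary D (f j) t ≡ 1) (trans (cong f cj≡i) fi≡a′) (f-boundary j))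
    prev≢next : f j ≢ f (cyc i)
    prev≢next eq = cyc²≢id i 3≤1+k (trans (sym (cong cyc (f-inj eq))) cj≡i)

  neighbours-del : ∀ y → Adj G (ι y) v → y ≡ a′ ⊎ y ≡ b′
  neighbours-del y ιy~v = ⊎-map (λ eq → punchIn-injective v _ _ (trans eq (sym ιa′≡a)))
                                (λ eq → punchIn-injective v _ _ (trans eq (sym ιb′≡b)))
                                (neighbours (Adj-sym G ιy~v))

  boundary-to-v : ∀ y → y ≡ a′ ⊎ y ≡ b′ → boundary G v (ι y) ≡ 1
  boundary-to-v y (inj₁ refl) = boundary-at-v (subst (Adj G v) (sym ιa′≡a) va)
  boundary-to-v y (inj₂ refl) = boundary-at-v (subst (Adj G v) (sym ιb′≡b) vb)

  IsPair-ends : ∀ {s t} → IsPair s t → (s ≡ a′ ⊎ s ≡ b′) × (t ≡ a′ ⊎ t ≡ b′)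
  IsPair-ends (inj₁ (s≡a′ , t≡b′)) = inj₁ s≡a′ , inj₂ t≡b′
  IsPair-ends (inj₂ (s≡b′ , t≡a′)) = inj₂ s≡b′ , inj₁ t≡a′

  IsPair⇒∈ : ∀ {s t y} → IsPair s t → y ≡ a′ ⊎ y ≡ b′ → y ≡ s ⊎ y ≡ t
  IsPair⇒∈ (inj₁ (refl , refl)) y∈ = y∈
  IsPair⇒∈ (inj₂ (refl , refl)) y∈ = swap y∈

  module _ {g : Fin (suc k) → Fin (suc k)} (g-inj : Injective _≡_ _≡_ g) (ends : IsPair (g (fromℕ k)) (g zero)) where

    toℕ-cyc-zero : toℕ (cyc {suc k} zero) ≡ 1
    toℕ-cyc-zero = cyc-< zero (≤-trans (s≤s z≤n) (s≤s⁻¹ 3≤1+k))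

    v-between-ends : ∀ x → Adj G (ι (g x)) v → x ≡ fromℕ k ⊎ x ≡ zero
    v-between-ends x ιgx~v = ⊎-map g-inj g-inj (IsPair⇒∈ ends (neighbours-del (g x) ιgx~v))

    not-both-adjacent : ∀ x → toℕ x < k → A G (ι (g x)) v * A G (ι (g (cyc x))) v ≡ 0
    not-both-adjacent x x<k with A≡0⊎Adj G (ι (g x)) v | A≡0⊎Adj G (ι (g (cyc x))) v
    ... | inj₁ A≡0 | _         rewrite A≡0 = refl
    ... | inj₂ _   | inj₁ A≡0  rewrite A≡0 = *-zeroʳ (A G (ι (g x)) v)
    ... | inj₂ x~v | inj₂ cx~v with v-between-ends x x~v
    ...   | inj₁ refl = ⊥-elim (<-irrefl (toℕ-fromℕ k) x<k)
    ...   | inj₂ refl with v-between-ends (cyc zero) cx~v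
    ...     | inj₁ c0≡last =
      ⊥-elim (<-irrefl (trans (sym toℕ-cyc-zero) (trans (cong toℕ c0≡last) (toℕ-fromℕ k))) (s≤s⁻¹ 3≤1+k))
    ...     | inj₂ c0≡0 with trans (sym toℕ-cyc-zero) (cong toℕ c0≡0)
    ...       | ()

  insert : BoundaryHamiltonian D → BoundaryHamiltonian G
  insert (_ , C) with consecutive-a′b′ C
  ... | s , pair with rotate {R = λ x y → boundary D x y ≡ 1} C s
  ... | (g , g-inj , g-boundary) , g-last≡ , g-zero≡ = m≤n⇒m≤1+n 3≤1+k ,
    HamCycle-insert {S = λ x y → boundary G x y ≡ 1} v g g-inj
      (λ x x<k → trans (boundary-del (g x) (g (cyc x)) (not-both-adjacent g-inj ends x x<k)) (g-boundary x))
      (trans (boundary-sym G _ v) (boundary-to-v (g (fromℕ k)) (proj₁ (IsPair-ends ends))))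
      (boundary-to-v (g zero) (proj₂ (IsPair-ends ends)))
    where
    ends : IsPair (g (fromℕ k)) (g zero)
    ends = subst₂ IsPair (sym g-last≡) (sym g-zero≡) pair

injective-avoiding : ∀ {k m} (p : Fin k → Fin (suc m)) → Injective _≡_ _≡_ p → ∀ a → (∀ i → a ≢ p i) →
                     Σ (Fin k → Fin m) λ q → Injective _≡_ _≡_ q × (∀ i → punchIn a (q i) ≡ p i)
injective-avoiding p p-inj a avoid =
  (λ i → punchOut (avoid i)) , (λ eq → p-inj (punchOut-injective (avoid _) (avoid _) eq)) , (λ i → punchIn-punchOut (avoid i))

does-sym : ∀ {n} (u w : Fin n) → does (u ≟ᶠ w) ≡ does (w ≟ᶠ u)
does-sym u w with u ≟ᶠ w | w ≟ᶠ u
... | yes _   | yes _   = refl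
... | no  _   | no  _   = refl
... | yes u≡w | no  w≢u = ⊥-elim (w≢u (sym u≡w))
... | no  u≢w | yes w≡u = ⊥-elim (u≢w (sym w≡u))

does-refl : ∀ {n} (u : Fin n) → does (u ≟ᶠ u) ≡ true
does-refl u with u ≟ᶠ u
... | yes _   = refl
... | no  u≢u = ⊥-elim (u≢u refl)

K : ∀ n → Graph n
K n = record
  { adj   = λ u w → not (does (u ≟ᶠ w))
  ; sym   = λ u w → cong not (does-sym u w)
  ; irref = λ u → cong not (does-refl u)
  }

boundary-cong : ∀ {n} (G H : Graph n) → (∀ u w → adj G u w ≡ adj H u w) → ∀ u w → boundary G u w ≡ boundary H u w
boundary-cong {n} G H G≡H u w =
  cong₂ (λ x c → 𝟙 x * 𝟙 (c ≡ᵇ 1)) (G≡H u w)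
        (sum-cong-≗ {n} λ x → cong₂ _*_ (cong 𝟙 (G≡H u x)) (cong 𝟙 (G≡H w x)))

module _ (G : Graph 3) (conn : Connected G) (LL : LocallyLinear G) where

  open IsPathOn

  order-3-complete : ∀ u w → u ≢ w → Adj G u w
  order-3-complete u w u≢w with adj G u w in uw
  ... | true  = refl
  ... | false = ⊥-elim (short (link G LL u) (link-len≥2 G ≤-refl conn LL u))
    where
    short : (L : PathOn G (Adj G u)) → ¬ (2 ≤ len G L)
    short (k , _ , p , P) 2≤k with injective-avoiding p (injective P) u (λ i → Adj⇒≢ G (within P i))
    ... | q , q-inj , ιq≡p with injective-avoiding q q-inj (punchOut u≢w) q≢w′
      where
      q≢w′ : ∀ i → punchOut u≢w ≢ q i
      q≢w′ i eq with trans (sym (punchIn-punchOut u≢w)) (trans (cong (punchIn u) eq) (ιq≡p i))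
      ... | refl with trans (sym (within P i)) uw
      ...   | ()
    ... | r , r-inj , _ = ≤⇒≯ (injective⇒≤ r-inj) 2≤k

  order-3-BoundaryHamiltonian : BoundaryHamiltonian G
  order-3-BoundaryHamiltonian = ≤-refl , (λ i → i) , (λ eq → eq) , on-cycle
    where
    G≡K : ∀ u w → adj G u w ≡ adj (K 3) u w
    G≡K u w with u ≟ᶠ w
    ... | yes refl = irref G u
    ... | no  u≢w  = order-3-complete u w u≢w
    on-cycle : ∀ i → boundary G i (cyc i) ≡ 1
    on-cycle zero             = boundary-cong G (K 3) G≡K zero (suc zero)
    on-cycle (suc zero)       = boundary-cong G (K 3) G≡K (suc zero) (suc (suc zero))
    on-cycle (suc (suc zero)) = boundary-cong G (K 3) G≡K (suc (suc zero)) zero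

few-edges⇒BoundaryHamiltonian : ∀ k (G : Graph (3 + k)) → Connected G → LocallyLinear G → size G < 2 * (3 + k) →
                                BoundaryHamiltonian G
few-edges⇒BoundaryHamiltonian zero    G conn LL _     = order-3-BoundaryHamiltonian G conn LL
few-edges⇒BoundaryHamiltonian (suc k) G conn LL few with any? (λ u → deg G u ≟ 2)
... | no  no-deg2      =
  ⊥-elim (<⇒≱ few (Counting.2n≤size G LL (link-len≥2 G (s≤s (s≤s (s≤s z≤n))) conn LL) (λ u d → no-deg2 (u , d))))
... | yes (v , deg≡2) = from-link (link G LL v) (trans (sym (link-deg≡len G LL v)) deg≡2)
  where
  from-link : (L : PathOn G (Adj G v)) → len G L ≡ 2 → BoundaryHamiltonian G
  from-link (_ , _ , p , P) refl = insert (few-edges⇒BoundaryHamiltonian k D conn-D LL-D few-D)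
    where
    open Insertion G LL conn (s≤s (s≤s (s≤s z≤n))) v P
    open Deletion G v using (D; size-del)
    few-D : size D < 2 * (3 + k)
    few-D = +-cancelˡ-< 2 (size D) (2 * (3 + k)) (begin-strict
      2 + size D           ≡⟨ cong (_+ size D) deg≡2 ⟨
      deg G v + size D     ≡⟨ size-del ⟨
      size G               <⟨ few ⟩
      2 * (4 + k)          ≡⟨ *-suc 2 (3 + k) ⟩
      2 + 2 * (3 + k)      ∎)
      where open ≤-Reasoning

nonhamiltonian⇒2n≤size : (n : ℕ) → (G : Graph n) → 3 ≤ n → Connected G → ¬ Hamiltonian G → LocallyLinear G →
                         2 * n ≤ size G
nonhamiltonian⇒2n≤size (suc zero)       _ (s≤s ())       _ _ _
nonhamiltonian⇒2n≤size (suc (suc zero)) _ (s≤s (s≤s ())) _ _ _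
nonhamiltonian⇒2n≤size (suc (suc (suc k))) G _ conn ¬ham LL with 2 * (3 + k) ≤? size G
... | yes enough = enough
... | no  few    = ⊥-elim (¬ham (BoundaryHamiltonian⇒Hamiltonian G (few-edges⇒BoundaryHamiltonian k G conn LL (≰⇒> few))))

-- A gadget that blocks Hamiltonian cycles
NbhdWithin : ∀ {N} → Graph N → Fin N → Fin N → Fin N → Set
NbhdWithin H t p q = ∀ u → Adj H t u → u ≡ p ⊎ u ≡ q

NbhdWithin-swap : ∀ {N} (H : Graph N) {t p q} → NbhdWithin H t p q → NbhdWithin H t q p
NbhdWithin-swap H nb u = swap ∘ nb u

module OnHamCycle {N} (H : Graph N) (3≤N : 3 ≤ N) (C : HamCycle (Adj H)) where

  f : Fin N → Fin N
  f = proj₁ C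

  f-inj : Injective _≡_ _≡_ f
  f-inj = proj₁ (proj₂ C)

  f-adj : ∀ i → Adj H (f i) (f (cyc i))
  f-adj = proj₂ (proj₂ C)

  closure : (S : Fin N → Set) → (∀ j → S (f j) → S (f (cyc j))) → ∀ {u₀} → S u₀ → ∀ u → S u
  closure S closed {u₀} Su₀ u with injective⇒surjective f f-inj u₀ | injective⇒surjective f f-inj u
  ... | j , refl | i , refl with cyc^-reaches j i
  ... | r , refl = iterate r
    where
    iterate : ∀ r → S (f (cyc^ r j))
    iterate zero    = Su₀
    iterate (suc r) = closed (cyc^ r j) (iterate r)

  after-degree-two : ∀ {t p q} → NbhdWithin H t p q → ∀ {j} → f j ≡ t → f (cyc j) ≡ p ⊎ f (cyc j) ≡ q
  after-degree-two t-nbhd {j} refl = t-nbhd (f (cyc j)) (f-adj j)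

  after-neighbour : ∀ {t p q} → NbhdWithin H t p q → ∀ {j} → f j ≡ p →
                    f (cyc j) ≡ t ⊎ ∃ λ i → f i ≡ t × f (cyc i) ≡ p
  after-neighbour {t} {p} {q} t-nbhd {j} fj≡p with injective⇒surjective f f-inj t
  ... | i , refl with cyc-surjective i
  ... | h , refl with t-nbhd (f h) (Adj-sym H (f-adj h)) | t-nbhd (f (cyc (cyc h))) (f-adj (cyc h))
  ...   | inj₁ fh≡p | _ = inj₁ (cong (f ∘ cyc) (f-inj (trans fj≡p (sym fh≡p))))
  ...   | inj₂ _    | inj₁ next≡p = inj₂ (cyc h , refl , next≡p)
  ...   | inj₂ fh≡q | inj₂ next≡q = ⊥-elim (cyc²≢id h 3≤N (f-inj (trans next≡q (sym fh≡q))))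

  after-shared : ∀ {t₁ t₂ p q₁ q₂} → NbhdWithin H t₁ p q₁ → NbhdWithin H t₂ q₂ p → t₁ ≢ t₂ →
                 ∀ {j} → f j ≡ p → f (cyc j) ≡ t₁ ⊎ f (cyc j) ≡ t₂
  after-shared t₁-nbhd t₂-nbhd t₁≢t₂ fj≡p
    with after-neighbour t₁-nbhd fj≡p | after-neighbour (NbhdWithin-swap H t₂-nbhd) fj≡p
  ... | inj₁ next≡t₁ | _ = inj₁ next≡t₁
  ... | inj₂ _ | inj₁ next≡t₂ = inj₂ next≡t₂
  ... | inj₂ (i₁ , fi₁≡t₁ , next₁) | inj₂ (i₂ , fi₂≡t₂ , next₂) =
    ⊥-elim (t₁≢t₂ (trans (sym fi₁≡t₁) (trans (cong f (cyc-injective (f-inj (trans next₁ (sym next₂))))) fi₂≡t₂)))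

record Gadget {N} (H : Graph N) : Set where
  field
    a b c d x y z w o : Fin N
    x-nbhd : NbhdWithin H x a b
    y-nbhd : NbhdWithin H y b c
    z-nbhd : NbhdWithin H z c d
    w-nbhd : NbhdWithin H w d a
    x≢w    : x ≢ w
    y≢x    : y ≢ x
    z≢y    : z ≢ y
    w≢z    : w ≢ z
    o∉     : o ∉ a ∷ b ∷ c ∷ d ∷ x ∷ y ∷ z ∷ w ∷ []

Gadget⇒¬Hamiltonian : ∀ {N} {H : Graph N} → Gadget H → ¬ Hamiltonian H
Gadget⇒¬Hamiltonian {N} {H} g (3≤N , C) = o∉ (closure (_∈ octagon) closed a∈ o)
  where
  open Gadget g
  open OnHamCycle H 3≤N C
  octagon : List (Fin N)
  octagon = a ∷ b ∷ c ∷ d ∷ x ∷ y ∷ z ∷ w ∷ []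
  a∈ : a ∈ octagon
  a∈ = here refl
  b∈ : b ∈ octagon
  b∈ = there (here refl)
  c∈ : c ∈ octagon
  c∈ = there (there (here refl))
  d∈ : d ∈ octagon
  d∈ = there (there (there (here refl)))
  x∈ : x ∈ octagon
  x∈ = there (there (there (there (here refl))))
  y∈ : y ∈ octagon
  y∈ = there (there (there (there (there (here refl)))))
  z∈ : z ∈ octagon
  z∈ = there (there (there (there (there (there (here refl))))))
  w∈ : w ∈ octagon
  w∈ = there (there (there (there (there (there (there (here refl)))))))
  one-of : ∀ {u s₁ s₂} → u ≡ s₁ ⊎ u ≡ s₂ → s₁ ∈ octagon → s₂ ∈ octagon → u ∈ octagon
  one-of (inj₁ refl) s₁∈ _ = s₁∈
  one-of (inj₂ refl) _ s₂∈ = s₂∈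
  closed : ∀ j → f j ∈ octagon → f (cyc j) ∈ octagon
  closed j (here eq)                                                             = one-of (after-shared x-nbhd w-nbhd x≢w eq) x∈ w∈
  closed j (there (here eq))                                                     = one-of (after-shared y-nbhd x-nbhd y≢x eq) y∈ x∈
  closed j (there (there (here eq)))                                             = one-of (after-shared z-nbhd y-nbhd z≢y eq) z∈ y∈
  closed j (there (there (there (here eq))))                                     = one-of (after-shared w-nbhd z-nbhd w≢z eq) w∈ z∈
  closed j (there (there (there (there (here eq)))))                             = one-of (after-degree-two x-nbhd eq) a∈ b∈
  closed j (there (there (there (there (there (here eq))))))                     = one-of (after-degree-two y-nbhd eq) b∈ c∈
  closed j (there (there (there (there (there (there (here eq)))))))             = one-of (after-degree-two z-nbhd eq) c∈ d∈
  closed j (there (there (there (there (there (there (there (here eq)))))))) = one-of (after-degree-two w-nbhd eq) d∈ a∈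

-- Attaching a vertex to a boundary edge
attached : ∀ {N} → Fin N → Fin N → Fin N → Bool
attached c e y = does (y ≟ᶠ c) ∨ does (y ≟ᶠ e)

ear-adj : ∀ {N} → Graph N → Fin N → Fin N → Fin (suc N) → Fin (suc N) → Bool
ear-adj H c e zero    zero    = false
ear-adj H c e zero    (suc y) = attached c e y
ear-adj H c e (suc x) zero    = attached c e x
ear-adj H c e (suc x) (suc y) = adj H x y

ear : ∀ {N} → Graph N → Fin N → Fin N → Graph (suc N)
ear H c e = record { adj = ear-adj H c e ; sym = ear-sym ; irref = ear-irref }
  where
  ear-sym : ∀ x y → ear-adj H c e x y ≡ ear-adj H c e y x
  ear-sym zero    zero    = refl
  ear-sym zero    (suc y) = refl
  ear-sym (suc x) zero    = refl
  ear-sym (suc x) (suc y) = adj-sym H x y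
  ear-irref : ∀ x → ear-adj H c e x x ≡ false
  ear-irref zero    = refl
  ear-irref (suc x) = irref H x

attached-c : ∀ {N} (c e : Fin N) → attached c e c ≡ true
attached-c c e rewrite does-refl c = refl

attached-e : ∀ {N} (c e : Fin N) → attached c e e ≡ true
attached-e c e rewrite does-refl e = ∨-zeroʳ _

attached⇒ : ∀ {N} {c e y : Fin N} → attached c e y ≡ true → y ≡ c ⊎ y ≡ e
attached⇒ {c = c} {e} {y} att with y ≟ᶠ c | y ≟ᶠ e
... | yes y≡c | _       = inj₁ y≡c
... | no  _   | yes y≡e = inj₂ y≡e

not-attached : ∀ {N} {c e y : Fin N} → y ≢ c → y ≢ e → attached c e y ≡ false
not-attached {c = c} {e} {y} y≢c y≢e with y ≟ᶠ c | y ≟ᶠ e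
... | yes y≡c | _       = ⊥-elim (y≢c y≡c)
... | no  _   | yes y≡e = ⊥-elim (y≢e y≡e)
... | no  _   | no  _   = refl

module Ear {N} (H : Graph N) {c e : Fin N} (ce-boundary : boundary H c e ≡ 1) where

  open IsPathOn

  E : Graph (suc N)
  E = ear H c e

  ce : Adj H c e
  ce = boundary⇒Adj H ce-boundary

  c≢e : c ≢ e
  c≢e = Adj⇒≢ H ce

  ∑-attached : ∀ (h : Fin N → ℕ) → ∑[ y < N ] (h y * 𝟙 (attached c e y)) ≡ h c + h e
  ∑-attached h = begin
    ∑[ y < N ] (h y * 𝟙 (attached c e y))                            ≡⟨ sum-cong-≗ {N} split ⟩
    ∑[ y < N ] (h y * 𝟙 (does (y ≟ᶠ c)) + h y * 𝟙 (does (y ≟ᶠ e)))   ≡⟨ ∑-distrib-+ {N} _ _ ⟩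
    ∑[ y < N ] (h y * 𝟙 (does (y ≟ᶠ c))) + ∑[ y < N ] (h y * 𝟙 (does (y ≟ᶠ e)))
                                                                      ≡⟨ cong₂ _+_ (at c) (at e) ⟩
    h c + h e                                                         ∎
    where
    open ≡-Reasoning
    split : ∀ y → h y * 𝟙 (attached c e y) ≡ h y * 𝟙 (does (y ≟ᶠ c)) + h y * 𝟙 (does (y ≟ᶠ e))
    split y = trans (cong (h y *_) (𝟙-∨ _ _ λ is-c is-e → c≢e (trans (sym (dec-true is-c)) (dec-true is-e))))
                    (*-distribˡ-+ (h y) _ _)
      where
      dec-true : ∀ {t} → does (y ≟ᶠ t) ≡ true → y ≡ t
      dec-true {t} eq with y ≟ᶠ t
      ... | yes y≡t = y≡t
    at : ∀ t → ∑[ y < N ] (h y * 𝟙 (does (y ≟ᶠ t))) ≡ h t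
    at t = trans (∑-delta t _ off-t) (trans (cong (λ b → h t * 𝟙 b) (does-refl t)) (*-identityʳ (h t)))
      where
      off-t : ∀ y → y ≢ t → h y * 𝟙 (does (y ≟ᶠ t)) ≡ 0
      off-t y y≢t with y ≟ᶠ t
      ... | yes y≡t = ⊥-elim (y≢t y≡t)
      ... | no  _   = *-zeroʳ (h y)

  size-ear : size E ≡ 2 + size H
  size-ear = trans (Deletion.size-del E zero) (cong (_+ size H) deg-new)
    where
    deg-new : deg E zero ≡ 2
    deg-new = trans (sum-cong-≗ {N} λ y → sym (*-identityˡ (𝟙 (attached c e y)))) (∑-attached (λ _ → 1))

  Reach-ear : ∀ {x y} → Reach H x y → Reach E (suc x) (suc y)
  Reach-ear here         = here
  Reach-ear (step xw wy) = step xw (Reach-ear wy)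

  Connected-ear : Connected H → Connected E
  Connected-ear conn zero    zero    = here
  Connected-ear conn zero    (suc y) = step (attached-c c e) (Reach-ear (conn c y))
  Connected-ear conn (suc x) zero    = Reach-trans E (Reach-ear (conn x c)) (step (attached-c c e) here)
  Connected-ear conn (suc x) (suc y) = Reach-ear (conn x y)

  new-boundary : boundary E (suc c) zero ≡ 1
  new-boundary = boundary-intro E {suc c} {zero} (attached-c c e) (begin
    common E (suc c) zero                  ≡⟨⟩
    A E (suc c) zero * 0 + ∑[ y < N ] (A H c y * 𝟙 (attached c e y))
                                           ≡⟨ cong₂ _+_ (*-zeroʳ (A E (suc c) zero)) (∑-attached (A H c)) ⟩
    0 + (A H c c + A H c e)                ≡⟨ cong₂ _+_ (A-irrefl H c) (Adj⇒A≡1 H ce) ⟩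
    1                                      ∎)
    where open ≡-Reasoning

  link-new : PathOn E (Adj E zero)
  link-new = 2 , s≤s z≤n , p , record
    { injective = injective′ ; within = within′ ; onto = onto′ ; edge⇒Dist1 = edge⇒Dist1′ ; Dist1⇒edge = Dist1⇒edge′ }
    where
    p : Fin 2 → Fin (suc N)
    p zero       = suc c
    p (suc zero) = suc e
    injective′ : Injective _≡_ _≡_ p
    injective′ {zero}     {zero}     _  = refl
    injective′ {zero}     {suc zero} eq = ⊥-elim (c≢e (Fin-suc-injective eq))
    injective′ {suc zero} {zero}     eq = ⊥-elim (c≢e (Fin-suc-injective (sym eq)))
    injective′ {suc zero} {suc zero} _  = refl
    within′ : ∀ i → Adj E zero (p i)
    within′ zero       = attached-c c e
    within′ (suc zero) = attached-e c e
    onto′ : ∀ u → Adj E zero u → ∃ λ i → p i ≡ u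
    onto′ (suc y) att with attached⇒ {c = c} {e} {y} att
    ... | inj₁ refl = zero , refl
    ... | inj₂ refl = suc zero , refl
    edge⇒Dist1′ : ∀ i j → Adj E (p i) (p j) → Dist1 (toℕ i) (toℕ j)
    edge⇒Dist1′ zero       zero       cc = ⊥-elim (Adj-irrefl H c cc)
    edge⇒Dist1′ zero       (suc zero) _  = inj₁ refl
    edge⇒Dist1′ (suc zero) zero       _  = inj₂ refl
    edge⇒Dist1′ (suc zero) (suc zero) ee = ⊥-elim (Adj-irrefl H e ee)
    Dist1⇒edge′ : ∀ i j → Dist1 (toℕ i) (toℕ j) → Adj E (p i) (p j)
    Dist1⇒edge′ zero       (suc zero) _ = ce
    Dist1⇒edge′ (suc zero) zero       _ = Adj-sym H ce
    Dist1⇒edge′ zero       zero       (inj₁ ())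
    Dist1⇒edge′ zero       zero       (inj₂ ())
    Dist1⇒edge′ (suc zero) (suc zero) (inj₁ ())
    Dist1⇒edge′ (suc zero) (suc zero) (inj₂ ())

  link-far : ∀ {u} → attached c e u ≡ false → PathOn H (Adj H u) → PathOn E (Adj E (suc u))
  link-far {u} far (k , k≥1 , q , Q) = k , k≥1 , suc ∘ q , record
    { injective = injective Q ∘ Fin-suc-injective ; within = within Q ; onto = onto′
    ; edge⇒Dist1 = edge⇒Dist1 Q ; Dist1⇒edge = Dist1⇒edge Q }
    where
    onto′ : ∀ x → Adj E (suc u) x → ∃ λ i → suc (q i) ≡ x
    onto′ zero    u~new with trans (sym far) u~new
    ... | ()
    onto′ (suc y) uy = let (i , qi≡y) = onto Q y uy in i , cong suc qi≡y

  prepend-new : ∀ {u o} → attached c e u ≡ true → attached c e o ≡ true →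
                (∀ {y} → attached c e y ≡ true → y ≡ u ⊎ y ≡ o) →
                ∀ {k} {q : Fin (suc k) → Fin N} → IsPathOn H (Adj H u) q → q zero ≡ o → PathOn E (Adj E (suc u))
  prepend-new {u} {o} u-att o-att att⇒ {k} {q} Q q0≡o = suc (suc k) , s≤s z≤n , p , record
    { injective = injective′ ; within = within′ ; onto = onto′ ; edge⇒Dist1 = edge⇒Dist1′ ; Dist1⇒edge = Dist1⇒edge′ }
    where
    p : Fin (suc (suc k)) → Fin (suc N)
    p zero    = zero
    p (suc i) = suc (q i)
    injective′ : Injective _≡_ _≡_ p
    injective′ {zero}  {zero}  _  = refl
    injective′ {suc i} {suc j} eq = cong suc (injective Q (Fin-suc-injective eq))
    within′ : ∀ i → Adj E (suc u) (p i)
    within′ zero    = u-att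
    within′ (suc i) = within Q i
    onto′ : ∀ x → Adj E (suc u) x → ∃ λ i → p i ≡ x
    onto′ zero    _  = zero , refl
    onto′ (suc y) uy = let (i , qi≡y) = onto Q y uy in suc i , cong suc qi≡y
    attached⇒head : ∀ i → attached c e (q i) ≡ true → toℕ i ≡ 0
    attached⇒head i att with att⇒ att
    ... | inj₁ qi≡u = ⊥-elim (Adj⇒≢ H (within Q i) (sym qi≡u))
    ... | inj₂ qi≡o = cong toℕ (injective Q (trans qi≡o (sym q0≡o)))
    head⇒attached : ∀ i → toℕ i ≡ 0 → attached c e (q i) ≡ true
    head⇒attached zero _ = subst (λ t → attached c e t ≡ true) (sym q0≡o) o-att
    edge⇒Dist1′ : ∀ i j → Adj E (p i) (p j) → Dist1 (toℕ i) (toℕ j)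
    edge⇒Dist1′ zero    (suc j) att = inj₁ (cong suc (sym (attached⇒head j att)))
    edge⇒Dist1′ (suc i) zero    att = inj₂ (cong suc (sym (attached⇒head i att)))
    edge⇒Dist1′ (suc i) (suc j) qq  = Dist1-suc (edge⇒Dist1 Q i j qq)
    Dist1⇒edge′ : ∀ i j → Dist1 (toℕ i) (toℕ j) → Adj E (p i) (p j)
    Dist1⇒edge′ zero    zero    (inj₁ ())
    Dist1⇒edge′ zero    zero    (inj₂ ())
    Dist1⇒edge′ zero    (suc j) (inj₁ 1≡1+j) = head⇒attached j (sym (suc-injective 1≡1+j))
    Dist1⇒edge′ (suc i) zero    (inj₂ 1≡1+i) = head⇒attached i (sym (suc-injective 1≡1+i))
    Dist1⇒edge′ (suc i) (suc j) d = Dist1⇒edge Q i j (Dist1-suc⁻¹ d)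

  link-end : ∀ {u o} → attached c e u ≡ true → attached c e o ≡ true →
             (∀ {y} → attached c e y ≡ true → y ≡ u ⊎ y ≡ o) →
             Adj H u o → common H u o ≡ 1 → PathOn H (Adj H u) → PathOn E (Adj E (suc u))
  link-end u-att o-att att⇒ uo common≡1 (suc k , _ , q , Q) with LinkProperties.common≡1⇒PathEnd H Q uo common≡1
  ... | j , qj≡o , j-end with orient H Q j j-end
  ... | q′ , Q′ , q′0≡qj = prepend-new u-att o-att att⇒ Q′ (trans q′0≡qj qj≡o)

  LocallyLinear-ear : LocallyLinear H → LocallyLinear E
  LocallyLinear-ear LL zero    = fromPathOn E {zero} link-new
  LocallyLinear-ear LL (suc u) with u ≟ᶠ c | u ≟ᶠ e
  ... | yes refl | _        = fromPathOn E {suc u} (link-end (attached-c c e) (attached-e c e) attached⇒ ce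
                                                     (boundary⇒common≡1 H ce-boundary) (link H LL c))
  ... | no _     | yes refl = fromPathOn E {suc u} (link-end (attached-e c e) (attached-c c e) (swap ∘ attached⇒) (Adj-sym H ce)
                                                     (trans (common-sym H e c) (boundary⇒common≡1 H ce-boundary)) (link H LL e))
  ... | no u≢c   | no u≢e   = fromPathOn E {suc u} (link-far (not-attached u≢c u≢e) (link H LL u))

  NbhdWithin-ear : ∀ {t p q} → attached c e t ≡ false → NbhdWithin H t p q → NbhdWithin E (suc t) (suc p) (suc q)
  NbhdWithin-ear far nb zero    t~new with trans (sym far) t~new
  ... | ()
  NbhdWithin-ear far nb (suc u) tu = ⊎-map (cong suc) (cong suc) (nb u tu)

  attached-ear : ∀ t → attached c e t ≡ false → attached (suc c) zero (suc t) ≡ false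
  attached-ear t far = not-attached {c = suc c} {zero} (λ eq → t≢c (Fin-suc-injective eq)) (λ ())
    where
    t≢c : t ≢ c
    t≢c refl with trans (sym far) (attached-c c e)
    ... | ()

-- The examples with 2n edges
module _ {n} (G : Graph n) where

  Adj? : ∀ u w → Dec (Adj G u w)
  Adj? u w = adj G u w ≟ᵇ true

  IsPathOn? : ∀ {N} → Decidable N → ∀ {k} (p : Fin k → Fin n) → Dec (IsPathOn G N p)
  IsPathOn? N? p = map′
    (λ (inj , within , onto , e⇒d , d⇒e) → record
      { injective = λ {i} {j} → inj i j ; within = within ; onto = onto ; edge⇒Dist1 = e⇒d ; Dist1⇒edge = d⇒e })
    (λ P → (λ i j → IsPathOn.injective P) , IsPathOn.within P , IsPathOn.onto P , IsPathOn.edge⇒Dist1 P , IsPathOn.Dist1⇒edge P)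
    ((all? λ i → all? λ j → (p i ≟ᶠ p j) →-dec (i ≟ᶠ j))
      ×-dec (all? λ i → N? (p i))
      ×-dec (all? λ u → N? u →-dec any? λ i → p i ≟ᶠ u)
      ×-dec (all? λ i → all? λ j → Adj? (p i) (p j) →-dec Dist1? (toℕ i) (toℕ j))
      ×-dec (all? λ i → all? λ j → Dist1? (toℕ i) (toℕ j) →-dec Adj? (p i) (p j)))

  NbhdWithin? : ∀ t p q → Dec (NbhdWithin G t p q)
  NbhdWithin? t p q = all? λ u → Adj? t u →-dec ((u ≟ᶠ p) ⊎-dec (u ≟ᶠ q))

-- A square 0123 with a vertex of degree 2 on each side (4–7), inside a square 8–11
-- that is joined to it by a band of eight triangles.
G₁₂-edges : List (ℕ × ℕ)
G₁₂-edges =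
  (0 , 1) ∷ (1 , 2) ∷ (2 , 3) ∷ (3 , 0) ∷
  (4 , 0) ∷ (4 , 1) ∷ (5 , 1) ∷ (5 , 2) ∷ (6 , 2) ∷ (6 , 3) ∷ (7 , 3) ∷ (7 , 0) ∷
  (8 , 9) ∷ (9 , 10) ∷ (10 , 11) ∷ (11 , 8) ∷
  (0 , 8) ∷ (1 , 8) ∷ (1 , 9) ∷ (2 , 9) ∷ (2 , 10) ∷ (3 , 10) ∷ (3 , 11) ∷ (0 , 11) ∷ []

listed : ℕ → ℕ → Bool
listed a b = any (λ (p , q) → (p ≡ᵇ a) ∧ (q ≡ᵇ b)) G₁₂-edges

G₁₂-adj : Fin 12 → Fin 12 → Bool
G₁₂-adj i j = listed (toℕ i) (toℕ j) ∨ listed (toℕ j) (toℕ i)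

G₁₂ : Graph 12
G₁₂ = record
  { adj   = G₁₂-adj
  ; sym   = λ i j → ∨-comm (listed (toℕ i) (toℕ j)) _
  ; irref = toWitness {a? = all? λ i → G₁₂-adj i i ≟ᵇ false} _
  }

G₁₂-link : Fin 12 → List (Fin 12)
G₁₂-link = lookup
  ( (# 4 ∷ # 1 ∷ # 8 ∷ # 11 ∷ # 3 ∷ # 7 ∷ [])
  ∷ (# 4 ∷ # 0 ∷ # 8 ∷ # 9 ∷ # 2 ∷ # 5 ∷ [])
  ∷ (# 5 ∷ # 1 ∷ # 9 ∷ # 10 ∷ # 3 ∷ # 6 ∷ [])
  ∷ (# 6 ∷ # 2 ∷ # 10 ∷ # 11 ∷ # 0 ∷ # 7 ∷ [])
  ∷ (# 0 ∷ # 1 ∷ [])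
  ∷ (# 1 ∷ # 2 ∷ [])
  ∷ (# 2 ∷ # 3 ∷ [])
  ∷ (# 0 ∷ # 3 ∷ [])
  ∷ (# 9 ∷ # 1 ∷ # 0 ∷ # 11 ∷ [])
  ∷ (# 8 ∷ # 1 ∷ # 2 ∷ # 10 ∷ [])
  ∷ (# 9 ∷ # 2 ∷ # 3 ∷ # 11 ∷ [])
  ∷ (# 8 ∷ # 0 ∷ # 3 ∷ # 10 ∷ [])
  ∷ [])

G₁₂-locallyLinear : LocallyLinear G₁₂
G₁₂-locallyLinear v =
  fromPathOn G₁₂ {v} (length (G₁₂-link v) , proj₁ (checked v) , lookup (G₁₂-link v) , proj₂ (checked v))
  where
  checked : ∀ v → 1 ≤ length (G₁₂-link v) × IsPathOn G₁₂ (Adj G₁₂ v) (lookup (G₁₂-link v))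
  checked = toWitness {a? = all? λ v → (1 ≤? length (G₁₂-link v))
                                       ×-dec IsPathOn? G₁₂ (Adj? G₁₂ v) (lookup (G₁₂-link v))} _

G₁₂-connected : Connected G₁₂
G₁₂-connected u v = Reach-trans G₁₂ (to-0 u) (Reach-sym G₁₂ (to-0 v))
  where
  near-0 : ∀ u → u ≡ # 0 ⊎ Adj G₁₂ u (# 0) ⊎ ∃ λ w → Adj G₁₂ u w × Adj G₁₂ w (# 0)
  near-0 = toWitness {a? = all? λ u → (u ≟ᶠ # 0) ⊎-dec Adj? G₁₂ u (# 0)
                                       ⊎-dec any? λ w → Adj? G₁₂ u w ×-dec Adj? G₁₂ w (# 0)} _
  to-0 : ∀ u → Reach G₁₂ u (# 0)
  to-0 u with near-0 u
  ... | inj₁ refl                  = here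
  ... | inj₂ (inj₁ u0)             = step {w = # 0} u0 here
  ... | inj₂ (inj₂ (w , uw , w0))  = step {w = w} uw (step w0 here)

G₁₂-gadget : Gadget G₁₂
G₁₂-gadget = record
  { a = # 0 ; b = # 1 ; c = # 2 ; d = # 3 ; x = # 4 ; y = # 5 ; z = # 6 ; w = # 7 ; o = # 8
  ; x-nbhd = toWitness {a? = NbhdWithin? G₁₂ (# 4) (# 0) (# 1)} _
  ; y-nbhd = toWitness {a? = NbhdWithin? G₁₂ (# 5) (# 1) (# 2)} _
  ; z-nbhd = toWitness {a? = NbhdWithin? G₁₂ (# 6) (# 2) (# 3)} _
  ; w-nbhd = toWitness {a? = NbhdWithin? G₁₂ (# 7) (# 3) (# 0)} _
  ; x≢w = λ () ; y≢x = λ () ; z≢y = λ () ; w≢z = λ ()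
  ; o∉ = toWitnessFalse {a? = Any.any? (# 8 ≟ᶠ_) (# 0 ∷ # 1 ∷ # 2 ∷ # 3 ∷ # 4 ∷ # 5 ∷ # 6 ∷ # 7 ∷ [])} _
  }

record SharpExample {N} (H : Graph N) : Set where
  field
    locallyLinear : LocallyLinear H
    connected     : Connected H
    size≡2N       : size H ≡ 2 * N
    gadget        : Gadget H
    c e           : Fin N
    ce-boundary   : boundary H c e ≡ 1
  open Gadget gadget using (x; y; z; w)
  field
    x-away : attached c e x ≡ false
    y-away : attached c e y ≡ false
    z-away : attached c e z ≡ false
    w-away : attached c e w ≡ false

G₁₂-sharp : SharpExample G₁₂
G₁₂-sharp = record
  { locallyLinear = G₁₂-locallyLinear ; connected = G₁₂-connected ; size≡2N = refl ; gadget = G₁₂-gadget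
  ; c = # 8 ; e = # 9 ; ce-boundary = refl ; x-away = refl ; y-away = refl ; z-away = refl ; w-away = refl }

SharpExample-ear : ∀ {N} {H : Graph N} (S : SharpExample H) → SharpExample (ear H (SharpExample.c S) (SharpExample.e S))
SharpExample-ear {N} {H} S = record
  { locallyLinear = LocallyLinear-ear locallyLinear
  ; connected     = Connected-ear connected
  ; size≡2N       = trans size-ear (trans (cong (2 +_) size≡2N) (sym (*-suc 2 N)))
  ; gadget        = record
    { a = suc a ; b = suc b ; c = suc c′ ; d = suc d ; x = suc x ; y = suc y ; z = suc z ; w = suc w ; o = suc o
    ; x-nbhd = NbhdWithin-ear x-away x-nbhd ; y-nbhd = NbhdWithin-ear y-away y-nbhd
    ; z-nbhd = NbhdWithin-ear z-away z-nbhd ; w-nbhd = NbhdWithin-ear w-away w-nbhd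
    ; x≢w = x≢w ∘ Fin-suc-injective ; y≢x = y≢x ∘ Fin-suc-injective
    ; z≢y = z≢y ∘ Fin-suc-injective ; w≢z = w≢z ∘ Fin-suc-injective
    ; o∉ = suc-o∉
    }
  ; c = suc c ; e = zero ; ce-boundary = new-boundary
  ; x-away = attached-ear x x-away ; y-away = attached-ear y y-away ; z-away = attached-ear z z-away ; w-away = attached-ear w w-away
  }
  where
  open SharpExample S
  open Gadget gadget renaming (c to c′)
  open Ear H ce-boundary
  suc-o∉ : suc o ∉ map suc (a ∷ b ∷ c′ ∷ d ∷ x ∷ y ∷ z ∷ w ∷ [])
  suc-o∉ m with ∈-map⁻ suc m
  ... | u , u∈ , eq = o∉ (subst (_∈ _) (sym (Fin-suc-injective eq)) u∈)

sharp-examples : ∀ j → Σ (Graph (12 + j)) SharpExample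
sharp-examples zero    = G₁₂ , G₁₂-sharp
sharp-examples (suc j) = let (H , S) = sharp-examples j in ear H (SharpExample.c S) (SharpExample.e S) , SharpExample-ear S

sharp-example : (n : ℕ) → 12 ≤ n → Σ (Graph n) λ G → Connected G × ¬ Hamiltonian G × LocallyLinear G × size G ≡ 2 * n
sharp-example n 12≤n with m≤n⇒∃[o]m+o≡n 12≤n
... | j , refl = let (H , S) = sharp-examples j; open SharpExample S in
  H , connected , Gadget⇒¬Hamiltonian gadget , locallyLinear , size≡2N

theorem2 : ((n : ℕ) → (G : Graph n) → 3 ≤ n → Connected G → ¬ Hamiltonian G → LocallyLinear G → 2 * n ≤ size G)
           × ((n : ℕ) → 12 ≤ n → Σ (Graph n) λ G → Connected G × ¬ Hamiltonian G × LocallyLinear G × size G ≡ 2 * n)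
theorem2 = nonhamiltonian⇒2n≤size , sharp-example
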